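{- Let $T$ be a tree which is not a path and let $k\ge 2$ be an integer. If $\operatorname{ter}(w)=2$ and $\varsigma(w)=k$ for every $w\in\mathcal{M}(T)$, then $\dim_k(T)=|\mathcal{D}_k(T)|$.
   Context: For a connected graph $G$ with shortest-path distance $d_G$: for distinct $x,y$, $\mathcal{D}_G(x,y)=\{z: d_G(x,z)\ne d_G(y,z)\}$; a set $S$ is a $k$-metric generator if $|S\cap \mathcal{D}_G(x,y)|\ge k$ for all distinct $x,y$; $\dim_k(G)$ is the minimum cardinality of a $k$-metric generator; $\mathcal{D}_k(G)=\bigcup\{\mathcal{D}_G(x,y): x\ne y,\ |\mathcal{D}_G(x,y)|=k\}$. A major vertex has degree at least $3$. A degree-one vertex $u$ is a terminal vertex of a major vertex $v$ if $d_G(u,v)<d_G(u,w)$ for every other major vertex $w$; $\operatorname{ter}(v)$ is the number of terminal vertices of $v$; $\mathcal{M}(G)$ is the set of major vertices with $\operatorname{ter}(v)>1$. For $w\in\mathcal{M}(G)$ and distinct terminal vertices $u_j,u_r$ of $w$, $\varsigma(u_j,u_r)$ is the length of a shortest $u_j$–$u_r$ path containing $w$, and $\varsigma(w)$ is the minimum of these over distinct pairs. -}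

module Defs where

open import Data.Nat using (ℕ; zero; suc; _+_; _≤_; _<_)
open import Data.Fin using (Fin; zero; suc; fromℕ; inject₁; toℕ)
open import Data.Fin.Subset using (Subset; _∈_; ∣_∣)
open import Data.Bool using (Bool; true; false)
open import Data.Vec using (tabulate)
open import Data.Product using (Σ; ∃; _×_; _,_)
open import Data.Sum using (_⊎_)
open import Relation.Binary.PropositionalEquality using (_≡_; _≢_)
open import Relation.Nullary using (¬_)
open import Function.Definitions using (Injective)
open import Function.Bundles using (_⇔_)

record Graph (n : ℕ) : Set where
  field
    adj    : Fin n → Fin n → Bool
    sym    : ∀ x y → adj x y ≡ adj y x
    irrefl : ∀ x → adj x x ≡ false

module _ {n : ℕ} (G : Graph n) where
  open Graph G

  Adj : Fin n → Fin n → Set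
  Adj x y = adj x y ≡ true

  IsWalk : (ℓ : ℕ) → (Fin (suc ℓ) → Fin n) → Fin n → Fin n → Set
  IsWalk ℓ f x y = f zero ≡ x × f (fromℕ ℓ) ≡ y
                   × (∀ (i : Fin ℓ) → Adj (f (inject₁ i)) (f (suc i)))

  Walk : Fin n → Fin n → ℕ → Set
  Walk x y ℓ = Σ (Fin (suc ℓ) → Fin n) λ f → IsWalk ℓ f x y

  Path : Fin n → Fin n → ℕ → Set
  Path x y ℓ = Σ (Fin (suc ℓ) → Fin n) λ f →
                 IsWalk ℓ f x y × Injective _≡_ _≡_ f

  PathVia : Fin n → Fin n → Fin n → ℕ → Set
  PathVia x w y ℓ = Σ (Fin (suc ℓ) → Fin n) λ f →
                 IsWalk ℓ f x y × Injective _≡_ _≡_ f × ∃ λ i → f i ≡ w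

  Connected : Set
  Connected = ∀ x y → ∃ λ ℓ → Walk x y ℓ

  -- a cycle with (suc m) ≥ 3 distinct vertices
  HasCycle : Set
  HasCycle = Σ ℕ λ m → 2 ≤ m × Σ (Fin (suc m) → Fin n) λ f →
               Injective _≡_ _≡_ f
               × (∀ (i : Fin m) → Adj (f (inject₁ i)) (f (suc i)))
               × Adj (f (fromℕ m)) (f zero)

  IsTree : Set
  IsTree = Connected × ¬ HasCycle

  IsPathGraph : Set
  IsPathGraph = Σ (Fin n → Fin n) λ f → Injective _≡_ _≡_ f ×
    (∀ i j → Adj (f i) (f j) ⇔ (toℕ i ≡ suc (toℕ j) ⊎ toℕ j ≡ suc (toℕ i)))

  Dist : Fin n → Fin n → ℕ → Set
  Dist x y d = Walk x y d × (∀ ℓ → Walk x y ℓ → d ≤ ℓ)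

  Distinguishes : Fin n → Fin n → Fin n → Set
  Distinguishes x y z = ∃ λ d₁ → ∃ λ d₂ → Dist x z d₁ × Dist y z d₂ × d₁ ≢ d₂

  HasCard : (Fin n → Set) → ℕ → Set
  HasCard P m = Σ (Fin m → Fin n) λ f → Injective _≡_ _≡_ f
                × (∀ i → P (f i)) × (∀ z → P z → ∃ λ i → f i ≡ z)

  AtLeast : (Fin n → Set) → ℕ → Set
  AtLeast P k = Σ (Fin k → Fin n) λ f → Injective _≡_ _≡_ f × (∀ i → P (f i))

  IsKMetricGenerator : ℕ → Subset n → Set
  IsKMetricGenerator k S = ∀ x y → x ≢ y →
    AtLeast (λ z → z ∈ S × Distinguishes x y z) k

  DimK : ℕ → ℕ → Set
  DimK k m = (Σ (Subset n) λ S → IsKMetricGenerator k S × ∣ S ∣ ≡ m)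
             × (∀ S → IsKMetricGenerator k S → m ≤ ∣ S ∣)

  InDk : ℕ → Fin n → Set
  InDk k z = ∃ λ x → ∃ λ y → x ≢ y × HasCard (Distinguishes x y) k
             × Distinguishes x y z

  degree : Fin n → ℕ
  degree x = ∣ tabulate (adj x) ∣

  IsMajor : Fin n → Set
  IsMajor v = 3 ≤ degree v

  IsTerminal : Fin n → Fin n → Set
  IsTerminal v u = IsMajor v × degree u ≡ 1 ×
    (∀ w → IsMajor w → w ≢ v → ∀ d₁ d₂ → Dist u v d₁ → Dist u w d₂ → d₁ < d₂)

  Ter : Fin n → ℕ → Set
  Ter v t = HasCard (IsTerminal v) t

  InM : Fin n → Set
  InM v = IsMajor v × Σ ℕ λ t → Ter v t × 2 ≤ t

  VarsigmaPair : Fin n → Fin n → Fin n → ℕ → Set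
  VarsigmaPair w u u' s = PathVia u w u' s × (∀ ℓ → PathVia u w u' ℓ → s ≤ ℓ)

  Varsigma : Fin n → ℕ → Set
  Varsigma w s =
    (∃ λ u → ∃ λ u' → IsTerminal w u × IsTerminal w u' × u ≢ u' × VarsigmaPair w u u' s)
    × (∀ u u' → IsTerminal w u → IsTerminal w u' → u ≢ u' →
         ∀ s' → VarsigmaPair w u u' s' → s ≤ s')

module Submission where

-- Every k-metric generator contains 𝒟_k: when |𝒟(x,y)| = k it must contain all of
-- 𝒟(x,y) (Generators).  So it suffices that every pair x ≢ y is distinguished by k
-- vertices of 𝒟_k (KeyLemma.every-pair-good).  For an edge a–b, the branch at a is
-- the set of vertices closer to a than to b; it is a leg if it has no major vertex.
-- Descending through a branch one finds only legs, or a major w with two legs at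
-- neighbours q₁, q₂ (good-or-leg).  Then w ∈ ℳ(T), the leg ends are its terminal
-- vertices, and the k vertices ≠ w of the path of length ς(w) = k between them are
-- exactly the vertices distinguishing q₁ and q₂, hence lie in 𝒟_k (legs-path-good).
-- For x, y the branches at the middle edge or middle vertex of their geodesic
-- distinguish them; if those branches are all legs, T is a path.

open import Defs
open import Data.Nat using (ℕ; zero; suc; _+_; _≤_; _<_; z≤n; s≤s; _≤?_; _<?_; _≟_)
open import Data.Nat.Properties
open import Data.Nat.Induction using (<-rec)
open import Data.Bool using (Bool; true; false)
import Data.Bool.Properties as Bool
open import Data.Fin using (Fin; zero; suc; fromℕ; inject₁; inject≤; punchIn; punchOut; toℕ; fromℕ<; cast)
import Data.Fin.Properties as Fin
open import Data.Fin.Subset using (Subset; ∣_∣) renaming (_∈_ to _∈ₛ_)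
open import Data.Vec using (tabulate; _∷_; here; there)
open import Data.Fin.Subset.Properties using (p⊆q⇒∣p∣≤∣q∣; p⊂q⇒∣p∣<∣q∣)
open import Data.Vec.Properties using (lookup∘tabulate; []=⇒lookup; lookup⇒[]=)
open import Data.List using (List; []; _∷_; _++_; reverse; length) renaming (tabulate to tabulateᴸ)
open import Data.List.Properties using (unfold-reverse)
open import Data.List.Membership.Propositional using (_∈_; _∉_)
open import Data.List.Membership.Propositional.Properties using (∈-++⁺ˡ; ∈-++⁻; ∈-tabulate⁺; ∈-tabulate⁻)
open import Data.List.Relation.Unary.Any using (here; there)
open import Data.List.Relation.Unary.Any.Properties using (reverse⁻)
open import Data.List.Relation.Binary.Disjoint.Propositional using (Disjoint)
open import Data.Product using (Σ; ∃; _×_; _,_; proj₁; proj₂)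
open import Data.Sum using (_⊎_; inj₁; inj₂; [_,_]′)
open import Data.Empty using (⊥; ⊥-elim)
open import Data.Unit using (⊤; tt)
open import Relation.Binary.PropositionalEquality
  using (_≡_; _≢_; refl; sym; trans; cong; cong₂; subst; subst₂; ≢-sym; module ≡-Reasoning)
open import Relation.Nullary using (¬_; Dec; yes; no; does; _×-dec_; ¬?; _→-dec_; map′)
open import Relation.Nullary.Decidable using (dec-true)
open import Relation.Unary using (Decidable)
open import Function.Definitions using (Injective)
open import Function.Bundles using (mk⇔)
open import Data.Nat.Tactic.RingSolver using (solve-∀)

∈ₛ-tabulate⁺ : ∀ {n} (f : Fin n → Bool) {x} → f x ≡ true → x ∈ₛ tabulate f
∈ₛ-tabulate⁺ f {x} fx = lookup⇒[]= x (tabulate f) (trans (lookup∘tabulate f x) fx)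

∈ₛ-tabulate⁻ : ∀ {n} (f : Fin n → Bool) {x} → x ∈ₛ tabulate f → f x ≡ true
∈ₛ-tabulate⁻ f {x} x∈ = trans (sym (lookup∘tabulate f x)) ([]=⇒lookup x∈)

module _ {n : ℕ} {P : Fin n → Set} (P? : Decidable P) where

  subsetOf : Subset n
  subsetOf = tabulate (λ x → does (P? x))

  ∈subsetOf⁺ : ∀ {x} → P x → x ∈ₛ subsetOf
  ∈subsetOf⁺ {x} px = ∈ₛ-tabulate⁺ _ (dec-true (P? x) px)

  ∈subsetOf⁻ : ∀ {x} → x ∈ₛ subsetOf → P x
  ∈subsetOf⁻ {x} x∈ with P? x | ∈ₛ-tabulate⁻ _ {x} x∈
  ... | yes px | _ = px
  ... | no _   | ()

enum : ∀ {n} (S : Subset n) → Fin ∣ S ∣ → Fin n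
enum (true ∷ S)  zero    = zero
enum (true ∷ S)  (suc i) = suc (enum S i)
enum (false ∷ S) i       = suc (enum S i)

enum-∈ : ∀ {n} (S : Subset n) i → enum S i ∈ₛ S
enum-∈ (true ∷ S)  zero    = here
enum-∈ (true ∷ S)  (suc i) = there (enum-∈ S i)
enum-∈ (false ∷ S) i       = there (enum-∈ S i)

enum-injective : ∀ {n} (S : Subset n) → Injective _≡_ _≡_ (enum S)
enum-injective (true ∷ S)  {zero}  {zero}  _  = refl
enum-injective (true ∷ S)  {suc i} {suc j} eq = cong suc (enum-injective S (Fin.suc-injective eq))
enum-injective (false ∷ S) eq = enum-injective S (Fin.suc-injective eq)

enum-onto : ∀ {n} (S : Subset n) {x} → x ∈ₛ S → ∃ λ i → enum S i ≡ x
enum-onto (true ∷ S)  here = zero , refl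
enum-onto (true ∷ S)  (there x∈) with enum-onto S x∈
... | i , eq = suc i , cong suc eq
enum-onto (false ∷ S) (there x∈) with enum-onto S x∈
... | i , eq = i , cong suc eq

injective⇒apart : ∀ {A B : Set} {f : A → B} → Injective _≡_ _≡_ f → ∀ {i j} → i ≢ j → f i ≢ f j
injective⇒apart f-inj i≢j eq = i≢j (f-inj eq)

-- If every value of an injection f : Fin a → Fin n is also a value of g : Fin b → Fin n,
-- then a ≤ b (f factors injectively through g).
image⊆⇒≤ : ∀ {n a b} (f : Fin a → Fin n) (g : Fin b → Fin n) →
           Injective _≡_ _≡_ f → (∀ i → ∃ λ j → g j ≡ f i) → a ≤ b
image⊆⇒≤ {a = a} {b} f g f-inj f⊆g = Fin.injective⇒≤ {f = index} index-inj
  where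
    index : Fin a → Fin b
    index i = proj₁ (f⊆g i)
    index-inj : Injective _≡_ _≡_ index
    index-inj {i} {j} eq = f-inj (begin
      f i         ≡⟨ sym (proj₂ (f⊆g i)) ⟩
      g (index i) ≡⟨ cong g eq ⟩
      g (index j) ≡⟨ proj₂ (f⊆g j) ⟩
      f j         ∎)
      where open ≡-Reasoning

injection⇒≤∣∣ : ∀ {n k} (S : Subset n) (f : Fin k → Fin n) →
                Injective _≡_ _≡_ f → (∀ i → f i ∈ₛ S) → k ≤ ∣ S ∣
injection⇒≤∣∣ S f f-inj f∈S = image⊆⇒≤ f (enum S) f-inj (λ i → enum-onto S (f∈S i))

≤∣∣⇒injection : ∀ {n k} (S : Subset n) → k ≤ ∣ S ∣ →
                Σ (Fin k → Fin n) λ f → Injective _≡_ _≡_ f × (∀ i → f i ∈ₛ S)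
≤∣∣⇒injection S k≤∣S∣ =
  (λ i → enum S (inject≤ i k≤∣S∣)) ,
  (λ eq → Fin.inject≤-injective k≤∣S∣ k≤∣S∣ _ _ (enum-injective S eq)) ,
  (λ i → enum-∈ S _)

injection-onto : ∀ {k} (φ : Fin k → Fin k) → Injective _≡_ _≡_ φ → ∀ i → ∃ λ j → φ j ≡ i
injection-onto {suc k} φ φ-inj i with Fin.any? (λ j → φ j Fin.≟ i)
... | yes hit = hit
... | no miss = ⊥-elim (<-irrefl refl (Fin.injective⇒≤ {f = ψ} ψ-inj))
  where
    -- φ avoids i, so it factors through Fin k by punching i out
    avoids : ∀ j → i ≢ φ j
    avoids j eq = miss (j , sym eq)
    ψ : Fin (suc k) → Fin k
    ψ j = punchOut (avoids j)
    ψ-inj : Injective _≡_ _≡_ ψ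
    ψ-inj {j} {j'} eq = φ-inj (Fin.punchOut-injective (avoids j) (avoids j') eq)

Fin2-cases : ∀ (i j l : Fin 2) → i ≢ j → l ≡ i ⊎ l ≡ j
Fin2-cases zero       zero       _          i≢j = ⊥-elim (i≢j refl)
Fin2-cases zero       (suc zero) zero       _   = inj₁ refl
Fin2-cases zero       (suc zero) (suc zero) _   = inj₂ refl
Fin2-cases (suc zero) zero       zero       _   = inj₂ refl
Fin2-cases (suc zero) zero       (suc zero) _   = inj₁ refl
Fin2-cases (suc zero) (suc zero) _          i≢j = ⊥-elim (i≢j refl)

module _ {n : ℕ} (G : Graph n) where

  hasCard-subsetOf : {P : Fin n → Set} (P? : Decidable P) → HasCard G P ∣ subsetOf P? ∣
  hasCard-subsetOf P? =
    enum S , enum-injective S , (λ i → ∈subsetOf⁻ P? (enum-∈ S i)) ,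
    (λ z pz → enum-onto S (∈subsetOf⁺ P? pz))
    where S = subsetOf P?

  -- Cardinalities are unique: two enumerations of P factor through each other.
  hasCard-unique : ∀ {P : Fin n → Set} {m m'} → HasCard G P m → HasCard G P m' → m ≡ m'
  hasCard-unique (f , f-inj , fP , f-onto) (g , g-inj , gP , g-onto) =
    ≤-antisym (image⊆⇒≤ f g f-inj (λ i → g-onto (f i) (fP i)))
              (image⊆⇒≤ g f g-inj (λ i → f-onto (g i) (gP i)))

  AtLeast-mono : ∀ {P Q : Fin n → Set} {k} → (∀ {z} → P z → Q z) → AtLeast G P k → AtLeast G Q k
  AtLeast-mono P⊆Q (f , f-inj , fP) = f , f-inj , λ i → P⊆Q (fP i)

  hasCard-punch : ∀ {k} {P : Fin n → Set} (f : Fin (suc k) → Fin n) → Injective _≡_ _≡_ f → ∀ j →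
                  (∀ i → i ≢ j → P (f i)) → (∀ {z} → P z → ∃ λ i → f i ≡ z) → ¬ P (f j) → HasCard G P k
  hasCard-punch {P = P} f f-inj j others onto ¬P-fj =
    (λ i → f (punchIn j i)) ,
    (λ eq → Fin.punchIn-injective j _ _ (f-inj eq)) ,
    (λ i → others (punchIn j i) (Fin.punchInᵢ≢i j i)) ,
    λ z pz → let (i , fi≡z) = onto pz
                 j≢i : j ≢ i
                 j≢i j≡i = ¬P-fj (subst P (trans (sym fi≡z) (cong f (sym j≡i))) pz)
             in punchOut j≢i , trans (cong f (Fin.punchIn-punchOut j≢i)) fi≡z

  hasCard-2 : ∀ {P : Fin n → Set} {x y z} → HasCard G P 2 → P x → P y → x ≢ y → P z → z ≡ x ⊎ z ≡ y
  hasCard-2 {x = x} {y} {z} (f , _ , _ , onto) px py x≢y pz with onto x px | onto y py | onto z pz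
  ... | i , refl | j , refl | l , refl with Fin2-cases i j l (λ i≡j → x≢y (cong f i≡j))
  ...   | inj₁ refl = inj₁ refl
  ...   | inj₂ refl = inj₂ refl

least : {P : ℕ → Set} → Decidable P → ∀ N → P N → Σ ℕ λ m → P m × (∀ j → P j → m ≤ j)
least {P} P? = <-rec Least search
  where
    Least : ℕ → Set
    Least N = P N → Σ ℕ λ m → P m × (∀ j → P j → m ≤ j)
    -- either some smaller j satisfies P (recurse on it) or N itself is least
    search : ∀ N → (∀ {j} → j < N → Least j) → Least N
    search N smaller pN with anyUpTo? P? N
    ... | yes (j , j<N , pj) = smaller j<N pj
    ... | no none = N , pN , λ j pj → ≮⇒≥ (λ j<N → none (j , j<N , pj))

halve : ∀ m → Σ ℕ λ h → m ≡ h + h ⊎ m ≡ h + suc h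
halve zero = 0 , inj₁ refl
halve (suc m) with halve m
... | h , inj₁ m≡h+h  = h , inj₂ (trans (cong suc m≡h+h) (sym (+-suc h h)))
... | h , inj₂ m≡h+sh = suc h , inj₁ (cong suc m≡h+sh)

-- A detour of length 2D that costs nothing has D = 0.
detour-free : ∀ A C D → (A + suc D) + (C + suc D) ≡ A + suc (suc C) → D ≡ 0
detour-free A C D eq = m+n≡0⇒m≡0 D (+-cancelˡ-≡ (A + suc (suc C)) (D + D) 0
  (trans (sym (rearrange A C D)) (trans eq (sym (+-identityʳ _)))))
  where
    rearrange : ∀ A C D → (A + suc D) + (C + suc D) ≡ (A + suc (suc C)) + (D + D)
    rearrange = solve-∀

-- The ∉-form of uniqueness; convenient to peel off the head by pattern matching.
Distinct : {A : Set} → List A → Set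
Distinct []       = ⊤
Distinct (x ∷ xs) = x ∉ xs × Distinct xs

module _ {A : Set} where

  Distinct-++⁺ : (xs ys : List A) → Distinct xs → Distinct ys → Disjoint xs ys → Distinct (xs ++ ys)
  Distinct-++⁺ []       ys _              ys! _     = ys!
  Distinct-++⁺ (x ∷ xs) ys (x∉xs , xs!) ys! xs#ys =
    x∉xs++ys , Distinct-++⁺ xs ys xs! ys! (λ (v∈xs , v∈ys) → xs#ys (there v∈xs , v∈ys))
    where
      x∉xs++ys : x ∉ xs ++ ys
      x∉xs++ys x∈ with ∈-++⁻ xs x∈
      ... | inj₁ x∈xs = x∉xs x∈xs
      ... | inj₂ x∈ys = xs#ys (here refl , x∈ys)

  Distinct-++ˡ : (xs ys : List A) → Distinct (xs ++ ys) → Distinct xs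
  Distinct-++ˡ []       ys _            = tt
  Distinct-++ˡ (x ∷ xs) ys (x∉ , rest!) = (λ x∈xs → x∉ (∈-++⁺ˡ x∈xs)) , Distinct-++ˡ xs ys rest!

  Distinct-reverse : (xs : List A) → Distinct xs → Distinct (reverse xs)
  Distinct-reverse []       _            = tt
  Distinct-reverse (x ∷ xs) (x∉xs , xs!) rewrite unfold-reverse x xs =
    Distinct-++⁺ (reverse xs) (x ∷ []) (Distinct-reverse xs xs!) ((λ ()) , tt)
      (λ { (x∈ , here refl) → x∉xs (reverse⁻ x∈) })

  Distinct-tabulate : ∀ {ℓ} (f : Fin ℓ → A) → Injective _≡_ _≡_ f → Distinct (tabulateᴸ f)
  Distinct-tabulate {zero}  f f-inj = tt
  Distinct-tabulate {suc ℓ} f f-inj =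
    (λ f0∈ → head-fresh (∈-tabulate⁻ f0∈)) ,
    Distinct-tabulate (λ i → f (suc i)) (λ eq → Fin.suc-injective (f-inj eq))
    where
      head-fresh : ¬ ∃ λ i → f zero ≡ f (suc i)
      head-fresh (i , eq) with f-inj eq
      ... | ()

-- Walks in a graph as an inductive family, with paths as walks without repeated vertices.

module Walks {n : ℕ} (G : Graph n) where
  open Graph G using (adj)
  open import Data.List.Membership.DecPropositional (Fin._≟_ {n}) public using (_∈?_)

  V : Set
  V = Fin n

  Adj-sym : ∀ {x y} → Adj G x y → Adj G y x
  Adj-sym {x} {y} xy = trans (sym (Graph.sym G x y)) xy

  Adj-irrefl : ∀ {x y} → Adj G x y → x ≢ y
  Adj-irrefl {x} xx refl with trans (sym xx) (Graph.irrefl G x)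
  ... | ()

  Adj? : ∀ x y → Dec (Adj G x y)
  Adj? x y = adj x y Bool.≟ true

  data _⇝_ : V → V → Set where
    stop : ∀ {s} → s ⇝ s
    step : ∀ {s v t} → Adj G s v → v ⇝ t → s ⇝ t

  len : ∀ {s t} → s ⇝ t → ℕ
  len stop       = 0
  len (step _ p) = suc (len p)

  verts later : ∀ {s t} → s ⇝ t → List V
  verts {s} p = s ∷ later p
  later stop       = []
  later (step _ p) = verts p

  Simple : ∀ {s t} → s ⇝ t → Set
  Simple p = Distinct (verts p)

  _++ᵂ_ : ∀ {s t u} → s ⇝ t → t ⇝ u → s ⇝ u
  stop     ++ᵂ q = q
  step e p ++ᵂ q = step e (p ++ᵂ q)

  len-++ᵂ : ∀ {s t u} (p : s ⇝ t) (q : t ⇝ u) → len (p ++ᵂ q) ≡ len p + len q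
  len-++ᵂ stop       q = refl
  len-++ᵂ (step _ p) q = cong suc (len-++ᵂ p q)

  verts-++ᵂ : ∀ {s t u} (p : s ⇝ t) (q : t ⇝ u) → verts (p ++ᵂ q) ≡ verts p ++ later q
  verts-++ᵂ stop       q = refl
  verts-++ᵂ {s} (step _ p) q = cong (s ∷_) (verts-++ᵂ p q)

  ∈-++ᵂˡ : ∀ {s t u z} (p : s ⇝ t) (q : t ⇝ u) → z ∈ verts p → z ∈ verts (p ++ᵂ q)
  ∈-++ᵂˡ {z = z} p q z∈ = subst (z ∈_) (sym (verts-++ᵂ p q)) (∈-++⁺ˡ z∈)

  reverseᵂ : ∀ {s t} → s ⇝ t → t ⇝ s
  reverseᵂ stop       = stop
  reverseᵂ (step e p) = reverseᵂ p ++ᵂ step (Adj-sym e) stop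

  verts-reverseᵂ : ∀ {s t} (p : s ⇝ t) → verts (reverseᵂ p) ≡ reverse (verts p)
  verts-reverseᵂ stop = refl
  verts-reverseᵂ {s} (step e p) = begin
    verts (reverseᵂ p ++ᵂ step (Adj-sym e) stop) ≡⟨ verts-++ᵂ (reverseᵂ p) _ ⟩
    verts (reverseᵂ p) ++ s ∷ []                 ≡⟨ cong (_++ s ∷ []) (verts-reverseᵂ p) ⟩
    reverse (verts p) ++ s ∷ []                  ≡⟨ sym (unfold-reverse s (verts p)) ⟩
    reverse (s ∷ verts p)                        ∎
    where open ≡-Reasoning

  len-reverseᵂ : ∀ {s t} (p : s ⇝ t) → len (reverseᵂ p) ≡ len p
  len-reverseᵂ stop       = refl
  len-reverseᵂ (step e p) = begin
    len (reverseᵂ p ++ᵂ step (Adj-sym e) stop) ≡⟨ len-++ᵂ (reverseᵂ p) _ ⟩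
    len (reverseᵂ p) + 1                       ≡⟨ cong (_+ 1) (len-reverseᵂ p) ⟩
    len p + 1                                  ≡⟨ +-comm (len p) 1 ⟩
    suc (len p)                                ∎
    where open ≡-Reasoning

  Simple-reverseᵂ : ∀ {s t} (p : s ⇝ t) → Simple p → Simple (reverseᵂ p)
  Simple-reverseᵂ p p! = subst Distinct (sym (verts-reverseᵂ p)) (Distinct-reverse (verts p) p!)

  ∈-reverseᵂ : ∀ {s t z} (p : s ⇝ t) → z ∈ verts (reverseᵂ p) → z ∈ verts p
  ∈-reverseᵂ p z∈ = reverse⁻ (subst (_ ∈_) (verts-reverseᵂ p) z∈)

  end∈verts : ∀ {s t} (p : s ⇝ t) → t ∈ verts p
  end∈verts stop       = here refl
  end∈verts (step _ p) = there (end∈verts p)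

  split : ∀ {s t z} (p : s ⇝ t) → z ∈ verts p → Σ (s ⇝ z) λ p₁ → Σ (z ⇝ t) λ p₂ → p ≡ p₁ ++ᵂ p₂
  split stop       (here refl) = stop , stop , refl
  split (step e p) (here refl) = stop , step e p , refl
  split (step e p) (there z∈) with split p z∈
  ... | p₁ , p₂ , eq = step e p₁ , p₂ , cong (step e) eq

  Simple-++ᵂˡ : ∀ {s t u} (p : s ⇝ t) (q : t ⇝ u) → Simple (p ++ᵂ q) → Simple p
  Simple-++ᵂˡ p q pq! = Distinct-++ˡ (verts p) (later q) (subst Distinct (verts-++ᵂ p q) pq!)

  Simple-++ᵂʳ : ∀ {s t u} (p : s ⇝ t) (q : t ⇝ u) → Simple (p ++ᵂ q) → Simple q
  Simple-++ᵂʳ stop       q q!         = q!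
  Simple-++ᵂʳ (step e p) q (_ , pq!) = Simple-++ᵂʳ p q pq!

  Simple-join : ∀ {x a b y} (p : x ⇝ a) (e : Adj G a b) (q : b ⇝ y) →
                Simple p → Simple q → Disjoint (verts p) (verts q) → Simple (p ++ᵂ step e q)
  Simple-join p e q p! q! p#q =
    subst Distinct (sym (verts-++ᵂ p (step e q))) (Distinct-++⁺ (verts p) (verts q) p! q! p#q)

  simple-or-shorter : ∀ {s t} (p : s ⇝ t) → Simple p ⊎ Σ (s ⇝ t) λ q → len q < len p
  simple-or-shorter stop = inj₁ ((λ ()) , tt)
  simple-or-shorter {s} (step e p) with simple-or-shorter p
  ... | inj₂ (q , q<p) = inj₂ (step e q , s≤s q<p)
  ... | inj₁ p! with s ∈? verts p
  ...   | no s∉p = inj₁ (s∉p , p!)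
  ...   | yes s∈p with split p s∈p
  ...     | p₁ , p₂ , refl = inj₂ (p₂ , s≤s (subst (len p₂ ≤_) (sym (len-++ᵂ p₁ p₂)) (m≤n+m (len p₂) (len p₁))))

  -- Translation to and from the vertex-sequence encoding of walks used in the statement.
  vertexAt : ∀ {s t} (p : s ⇝ t) → Fin (suc (len p)) → V
  vertexAt {s} p          zero    = s
  vertexAt     (step _ p) (suc i) = vertexAt p i

  vertexAt-last : ∀ {s t} (p : s ⇝ t) → vertexAt p (fromℕ (len p)) ≡ t
  vertexAt-last stop       = refl
  vertexAt-last (step _ p) = vertexAt-last p

  vertexAt-adj : ∀ {s t} (p : s ⇝ t) (i : Fin (len p)) → Adj G (vertexAt p (inject₁ i)) (vertexAt p (suc i))
  vertexAt-adj (step e p) zero    = e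
  vertexAt-adj (step e p) (suc i) = vertexAt-adj p i

  vertexAt-∈ : ∀ {s t} (p : s ⇝ t) i → vertexAt p i ∈ verts p
  vertexAt-∈ p          zero    = here refl
  vertexAt-∈ (step _ p) (suc i) = there (vertexAt-∈ p i)

  ∈⇒vertexAt : ∀ {s t z} (p : s ⇝ t) → z ∈ verts p → ∃ λ i → vertexAt p i ≡ z
  ∈⇒vertexAt p          (here refl) = zero , refl
  ∈⇒vertexAt (step _ p) (there z∈) with ∈⇒vertexAt p z∈
  ... | i , eq = suc i , eq

  vertexAt-injective : ∀ {s t} (p : s ⇝ t) → Simple p → Injective _≡_ _≡_ (vertexAt p)
  vertexAt-injective p          _          {zero}  {zero}  _  = refl
  vertexAt-injective (step e p) (s∉ , _)   {zero}  {suc j} eq =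
    ⊥-elim (s∉ (subst (_∈ verts p) (sym eq) (vertexAt-∈ p j)))
  vertexAt-injective (step e p) (s∉ , _)   {suc i} {zero}  eq =
    ⊥-elim (s∉ (subst (_∈ verts p) eq (vertexAt-∈ p i)))
  vertexAt-injective (step e p) (_ , p!)   {suc i} {suc j} eq = cong suc (vertexAt-injective p p! eq)

  vertexAt-consecutive : ∀ {s t} (p : s ⇝ t) (i j : Fin (suc (len p))) → toℕ j ≡ suc (toℕ i) →
                         Adj G (vertexAt p i) (vertexAt p j)
  vertexAt-consecutive (step e p) zero    (suc zero) refl = e
  vertexAt-consecutive (step e p) (suc i) (suc j)    j≡i+1 = vertexAt-consecutive p i j (suc-injective j≡i+1)

  toWalk : ∀ {s t} (p : s ⇝ t) → Walk G s t (len p)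
  toWalk p = vertexAt p , refl , vertexAt-last p , vertexAt-adj p

  Steps : ∀ ℓ → (Fin (suc ℓ) → V) → Set
  Steps ℓ f = ∀ (i : Fin ℓ) → Adj G (f (inject₁ i)) (f (suc i))

  fromFunction : ∀ ℓ (f : Fin (suc ℓ) → V) → Steps ℓ f → f zero ⇝ f (fromℕ ℓ)
  fromFunction zero    f _    = stop
  fromFunction (suc ℓ) f next = step (next zero) (fromFunction ℓ (λ i → f (suc i)) (λ i → next (suc i)))

  len-fromFunction : ∀ ℓ (f : Fin (suc ℓ) → V) (next : Steps ℓ f) → len (fromFunction ℓ f next) ≡ ℓ
  len-fromFunction zero    f next = refl
  len-fromFunction (suc ℓ) f next = cong suc (len-fromFunction ℓ (λ i → f (suc i)) (λ i → next (suc i)))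

  verts-fromFunction : ∀ ℓ (f : Fin (suc ℓ) → V) (next : Steps ℓ f) →
                       verts (fromFunction ℓ f next) ≡ tabulateᴸ f
  verts-fromFunction zero    f next = refl
  verts-fromFunction (suc ℓ) f next =
    cong (f zero ∷_) (verts-fromFunction ℓ (λ i → f (suc i)) (λ i → next (suc i)))

  fromWalk : ∀ {x y ℓ} → Walk G x y ℓ → Σ (x ⇝ y) λ p → len p ≡ ℓ
  fromWalk {ℓ = ℓ} (f , refl , refl , next) = fromFunction ℓ f next , len-fromFunction ℓ f next

  fromPathVia : ∀ {x w y ℓ} (P : PathVia G x w y ℓ) →
                Σ (x ⇝ y) λ p → Simple p × verts p ≡ tabulateᴸ (proj₁ P)
  fromPathVia {ℓ = ℓ} (f , (refl , refl , next) , f-inj , _) =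
    fromFunction ℓ f next ,
    subst Distinct (sym (verts-fromFunction ℓ f next)) (Distinct-tabulate f f-inj) ,
    verts-fromFunction ℓ f next

module Distance {n : ℕ} (G : Graph n) (conn : Connected G) where
  open Walks G

  WalkOfLength : V → V → ℕ → Set
  WalkOfLength x y ℓ = Σ (x ⇝ y) λ p → len p ≡ ℓ

  walkOfLength? : ∀ x y ℓ → Dec (WalkOfLength x y ℓ)
  walkOfLength? x y zero with x Fin.≟ y
  ... | yes refl = yes (stop , refl)
  ... | no x≢y   = no λ { (stop , _) → x≢y refl ; (step _ _ , ()) }
  walkOfLength? x y (suc ℓ) with Fin.any? (λ v → Adj? x v ×-dec walkOfLength? v y ℓ)
  ... | yes (v , e , p , refl) = yes (step e p , refl)
  ... | no none = no λ { (stop , ()) ; (step e p , refl) → none (_ , e , p , refl) }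

  -- d x y is the least length of a walk from x to y; it is kept opaque so that
  -- the least-number search behind it never unfolds during type checking.
  opaque
    shortest : ∀ x y → Σ ℕ λ m → WalkOfLength x y m × (∀ j → WalkOfLength x y j → m ≤ j)
    shortest x y with conn x y
    ... | ℓ , w = least (walkOfLength? x y) ℓ (fromWalk w)

    d : V → V → ℕ
    d x y = proj₁ (shortest x y)

    shortestWalk : ∀ x y → WalkOfLength x y (d x y)
    shortestWalk x y = proj₁ (proj₂ (shortest x y))

    d-minimal : ∀ {x y} (p : x ⇝ y) → d x y ≤ len p
    d-minimal {x} {y} p = proj₂ (proj₂ (shortest x y)) (len p) (p , refl)

  Dist-d : ∀ x y → Dist G x y (d x y)
  Dist-d x y with shortestWalk x y
  ... | p , p≡d = subst (Walk G x y) p≡d (toWalk p) ,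
                  λ ℓ w → subst (d x y ≤_) (proj₂ (fromWalk w)) (d-minimal (proj₁ (fromWalk w)))

  Dist⇒≡d : ∀ {x y e} → Dist G x y e → e ≡ d x y
  Dist⇒≡d {x} {y} (w , e-minimal) = ≤-antisym (e-minimal (d x y) (proj₁ (Dist-d x y)))
    (subst (d x y ≤_) (proj₂ (fromWalk w)) (d-minimal (proj₁ (fromWalk w))))

  distinguishes : ∀ {x y z} → d x z ≢ d y z → Distinguishes G x y z
  distinguishes {x} {y} {z} d≢d = d x z , d y z , Dist-d x z , Dist-d y z , d≢d

  distinguishes⁻ : ∀ {x y z} → Distinguishes G x y z → d x z ≢ d y z
  distinguishes⁻ (_ , _ , D₁ , D₂ , d₁≢d₂) d≡d = d₁≢d₂ (trans (Dist⇒≡d D₁) (trans d≡d (sym (Dist⇒≡d D₂))))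

  distinguishes? : ∀ x y z → Dec (Distinguishes G x y z)
  distinguishes? x y z = map′ distinguishes distinguishes⁻ (¬? (d x z ≟ d y z))

  distinguishes-sym : ∀ {x y z} → Distinguishes G x y z → Distinguishes G y x z
  distinguishes-sym (d₁ , d₂ , D₁ , D₂ , d₁≢d₂) = d₂ , d₁ , D₂ , D₁ , ≢-sym d₁≢d₂

  shortest⇒simple : ∀ {x y} (p : x ⇝ y) → len p ≡ d x y → Simple p
  shortest⇒simple p p≡d with simple-or-shorter p
  ... | inj₁ p! = p!
  ... | inj₂ (q , q<p) = ⊥-elim (<-irrefl refl (<-≤-trans (subst (len q <_) p≡d q<p) (d-minimal q)))

  geodesic : ∀ x y → Σ (x ⇝ y) λ p → Simple p × len p ≡ d x y
  geodesic x y with shortestWalk x y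
  ... | p , p≡d = p , shortest⇒simple p p≡d , p≡d

  d-sym : ∀ x y → d x y ≡ d y x
  d-sym x y = ≤-antisym (via-reverse x y) (via-reverse y x)
    where
      via-reverse : ∀ x y → d x y ≤ d y x
      via-reverse x y with shortestWalk y x
      ... | p , p≡d = subst (d x y ≤_) (trans (len-reverseᵂ p) p≡d) (d-minimal (reverseᵂ p))

  d-refl : ∀ x → d x x ≡ 0
  d-refl x = n≤0⇒n≡0 (d-minimal (stop {x}))

  d-triangle : ∀ x y z → d x z ≤ d x y + d y z
  d-triangle x y z with shortestWalk x y | shortestWalk y z
  ... | p , p≡d | q , q≡d =
    subst (d x z ≤_) (trans (len-++ᵂ p q) (cong₂ _+_ p≡d q≡d)) (d-minimal (p ++ᵂ q))

  between-sym : ∀ {s t x} → d s x + d x t ≡ d s t → d t x + d x s ≡ d t s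
  between-sym {s} {t} {x} between = begin
    d t x + d x s   ≡⟨ cong₂ _+_ (d-sym t x) (d-sym x s) ⟩
    d x t + d s x   ≡⟨ +-comm (d x t) (d s x) ⟩
    d s x + d x t   ≡⟨ between ⟩
    d s t           ≡⟨ d-sym s t ⟩
    d t s           ∎
    where open ≡-Reasoning

  between⇒closer : ∀ {s t u x} → d s x + d x t ≡ d s t → d s u ≡ suc (d s t) → d x t < d x u
  between⇒closer {s} {t} {u} {x} between further = +-cancelˡ-≤ (d s x) (suc (d x t)) (d x u) (begin
    d s x + suc (d x t)   ≡⟨ +-suc (d s x) (d x t) ⟩
    suc (d s x + d x t)   ≡⟨ cong suc between ⟩
    suc (d s t)           ≡⟨ sym further ⟩
    d s u                 ≤⟨ d-triangle s x u ⟩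
    d s x + d x u         ∎)
    where open ≤-Reasoning

  d≡0⇒≡ : ∀ {x y} → d x y ≡ 0 → x ≡ y
  d≡0⇒≡ {x} {y} d≡0 with shortestWalk x y
  ... | stop , _ = refl
  ... | step _ _ , p≡d with trans p≡d d≡0
  ...   | ()

  d-pos : ∀ {x y} → x ≢ y → 1 ≤ d x y
  d-pos {x} {y} x≢y with d x y in eq
  ... | zero  = ⊥-elim (x≢y (d≡0⇒≡ eq))
  ... | suc _ = s≤s z≤n

  d-adj : ∀ {x y} → Adj G x y → d x y ≡ 1
  d-adj xy = ≤-antisym (d-minimal (step xy stop)) (d-pos (Adj-irrefl xy))

-- In a tree paths are unique, hence geodesic; this gives the distance facts used below.

module TreeDistance {n : ℕ} (G : Graph n) (conn : Connected G) (acyc : ¬ HasCycle G) where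
  open Walks G
  open Distance G conn

  nonempty : ∀ {x y} (p : x ⇝ y) → x ≢ y → 1 ≤ len p
  nonempty stop       x≢x = ⊥-elim (x≢x refl)
  nonempty (step _ _) _   = s≤s z≤n

  no-closing-edge : ∀ {s t} (C : s ⇝ t) → Simple C → 2 ≤ len C → ¬ Adj G t s
  no-closing-edge {s} C C! 2≤C ts = acyc (len C , 2≤C , vertexAt C , vertexAt-injective C C! ,
    vertexAt-adj C , subst (λ v → Adj G v s) (sym (vertexAt-last C)) ts)

  -- Two simple routes from distinct neighbours v₁, v₂ of s to a common vertex m,
  -- avoiding s and meeting only at m, would close a cycle through s.
  no-two-routes : ∀ {s v₁ v₂ m} → Adj G s v₁ → Adj G s v₂ → v₁ ≢ v₂ →
    (a : v₁ ⇝ m) (b : v₂ ⇝ m) → Simple a → Simple b → s ∉ verts a → s ∉ verts b →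
    (∀ {z} → z ∈ verts a → z ∈ verts b → z ≡ m) → ⊥
  no-two-routes {s} {v₁} {v₂} sv₁ sv₂ v₁≢v₂ a b a! b! s∉a s∉b meet =
    no-closing-edge (step sv₁ route) (s∉route , route!) (s≤s (nonempty route v₁≢v₂)) (Adj-sym sv₂)
    where
      route : v₁ ⇝ v₂
      route = a ++ᵂ reverseᵂ b
      back⊆b : ∀ {z} → z ∈ later (reverseᵂ b) → z ∈ verts b
      back⊆b z∈ = ∈-reverseᵂ b (there z∈)
      m∉back : _ ∉ later (reverseᵂ b)
      m∉back = proj₁ (Simple-reverseᵂ b b!)
      route! : Simple route
      route! = subst Distinct (sym (verts-++ᵂ a (reverseᵂ b)))
        (Distinct-++⁺ (verts a) _ a! (proj₂ (Simple-reverseᵂ b b!))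
          (λ (z∈a , z∈back) → m∉back (subst (_∈ _) (meet z∈a (back⊆b z∈back)) z∈back)))
      s∉route : s ∉ verts route
      s∉route s∈ with ∈-++⁻ (verts a) (subst (s ∈_) (verts-++ᵂ a (reverseᵂ b)) s∈)
      ... | inj₁ s∈a    = s∉a s∈a
      ... | inj₂ s∈back = s∉b (back⊆b s∈back)

  firstHit : ∀ {v t} (p : v ⇝ t) (L : List V) → t ∈ L →
    Σ V λ m → Σ (v ⇝ m) λ pa → Σ (m ⇝ t) λ rb →
      p ≡ pa ++ᵂ rb × m ∈ L × (∀ {z} → z ∈ verts pa → z ∈ L → z ≡ m)
  firstHit {v} p L t∈L with v ∈? L
  ... | yes v∈L = v , stop , p , refl , v∈L , λ { (here refl) _ → refl }
  firstHit stop       L t∈L | no v∉L = ⊥-elim (v∉L t∈L)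
  firstHit (step e p) L t∈L | no v∉L with firstHit p L t∈L
  ... | m , pa , rb , refl , m∈L , first =
    m , step e pa , rb , refl , m∈L , λ { (here refl) z∈L → ⊥-elim (v∉L z∈L) ; (there z∈) z∈L → first z∈ z∈L }

  simple-unique : ∀ {s t} (p q : s ⇝ t) → Simple p → Simple q → later p ≡ later q
  simple-unique stop       stop       _        _        = refl
  simple-unique stop       (step _ q) _        (s∉q , _) = ⊥-elim (s∉q (end∈verts q))
  simple-unique (step _ p) stop       (s∉p , _) _        = ⊥-elim (s∉p (end∈verts p))
  simple-unique (step {v = v₁} e₁ p) (step {v = v₂} e₂ q) (s∉p , p!) (s∉q , q!) with v₁ Fin.≟ v₂
  ... | yes refl = cong (v₁ ∷_) (simple-unique p q p! q!)
  ... | no v₁≢v₂ with firstHit p (verts q) (end∈verts q)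
  ...   | m , pa , rb , refl , m∈q , first with split q m∈q
  ...     | q₁ , q₂ , refl = ⊥-elim (no-two-routes e₁ e₂ v₁≢v₂ pa q₁
             (Simple-++ᵂˡ pa rb p!) (Simple-++ᵂˡ q₁ q₂ q!)
             (λ s∈pa → s∉p (∈-++ᵂˡ pa rb s∈pa)) (λ s∈q₁ → s∉q (∈-++ᵂˡ q₁ q₂ s∈q₁))
             (λ z∈pa z∈q₁ → first z∈pa (∈-++ᵂˡ q₁ q₂ z∈q₁)))

  simple⇒shortest : ∀ {s t} (p : s ⇝ t) → Simple p → len p ≡ d s t
  simple⇒shortest {s} {t} p p! with geodesic s t
  ... | g , g! , g≡d = begin
    len p                ≡⟨ len≡length p ⟩
    length (later p)     ≡⟨ cong length (simple-unique p g p! g!) ⟩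
    length (later g)     ≡⟨ sym (len≡length g) ⟩
    len g                ≡⟨ g≡d ⟩
    d s t                ∎
    where
      open ≡-Reasoning
      len≡length : ∀ {x y} (q : x ⇝ y) → len q ≡ length (later q)
      len≡length stop       = refl
      len≡length (step _ q) = cong suc (len≡length q)

  on-simple⇒between : ∀ {s t z} (p : s ⇝ t) → Simple p → z ∈ verts p → d s z + d z t ≡ d s t
  on-simple⇒between p p! z∈ with split p z∈
  ... | p₁ , p₂ , refl = begin
    d _ _ + d _ _      ≡⟨ sym (cong₂ _+_ (simple⇒shortest p₁ (Simple-++ᵂˡ p₁ p₂ p!))
                                         (simple⇒shortest p₂ (Simple-++ᵂʳ p₁ p₂ p!))) ⟩
    len p₁ + len p₂    ≡⟨ sym (len-++ᵂ p₁ p₂) ⟩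
    len (p₁ ++ᵂ p₂)    ≡⟨ simple⇒shortest (p₁ ++ᵂ p₂) p! ⟩
    d _ _              ∎
    where open ≡-Reasoning

  between⇒on-simple : ∀ {s t z} → d s z + d z t ≡ d s t → (p : s ⇝ t) → Simple p → z ∈ verts p
  between⇒on-simple {s} {t} {z} between p p! with geodesic s z | geodesic z t
  ... | g₁ , _ , g₁≡d | g₂ , _ , g₂≡d =
    subst (z ∈_) (cong (s ∷_) (simple-unique g p (shortest⇒simple g g≡d) p!)) (∈-++ᵂˡ g₁ g₂ (end∈verts g₁))
    where
      g : s ⇝ t
      g = g₁ ++ᵂ g₂
      g≡d : len g ≡ d s t
      g≡d = trans (len-++ᵂ g₁ g₂) (trans (cong₂ _+_ g₁≡d g₂≡d) between)

  join : ∀ {x a b y} (p : x ⇝ a) (e : Adj G a b) (q : b ⇝ y) → Simple p → Simple q →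
         Disjoint (verts p) (verts q) → d x y ≡ len p + suc (len q)
  join p e q p! q! p#q =
    trans (sym (simple⇒shortest (p ++ᵂ step e q) (Simple-join p e q p! q! p#q))) (len-++ᵂ p (step e q))

  parity : ∀ {a b} → Adj G a b → ∀ z → d b z ≡ suc (d a z) ⊎ d a z ≡ suc (d b z)
  parity {a} {b} ab z with geodesic z a
  ... | g , g! , g≡d with b ∈? verts g
  ... | yes b∈g = inj₂ (begin
    d a z           ≡⟨ d-sym a z ⟩
    d z a           ≡⟨ sym (on-simple⇒between g g! b∈g) ⟩
    d z b + d b a   ≡⟨ cong (d z b +_) (d-adj (Adj-sym ab)) ⟩
    d z b + 1       ≡⟨ +-comm (d z b) 1 ⟩
    suc (d z b)     ≡⟨ cong suc (d-sym z b) ⟩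
    suc (d b z)     ∎)
    where open ≡-Reasoning
  ... | no b∉g = inj₁ (begin
    d b z           ≡⟨ d-sym b z ⟩
    d z b           ≡⟨ join g ab stop g! ((λ ()) , tt) (λ { (b∈ , here refl) → b∉g b∈ }) ⟩
    len g + 1       ≡⟨ cong (_+ 1) g≡d ⟩
    d z a + 1       ≡⟨ +-comm (d z a) 1 ⟩
    suc (d z a)     ≡⟨ cong suc (d-sym z a) ⟩
    suc (d a z)     ∎)
    where open ≡-Reasoning

  vertexAt-distance : ∀ {s t} (p : s ⇝ t) → Simple p → ∀ i → d s (vertexAt p i) ≡ toℕ i
  vertexAt-distance {s} p          _          zero    = d-refl s
  vertexAt-distance {s} {t} (step {v = v} e p) (s∉ , p!) (suc i) = begin
    d s z                ≡⟨ +-cancelʳ-≡ (d z t) (d s z) (suc (d v z)) (begin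
      d s z + d z t        ≡⟨ on-simple⇒between (step e p) (s∉ , p!) (there (vertexAt-∈ p i)) ⟩
      d s t                ≡⟨ sym (simple⇒shortest (step e p) (s∉ , p!)) ⟩
      suc (len p)          ≡⟨ cong suc (simple⇒shortest p p!) ⟩
      suc (d v t)          ≡⟨ cong suc (sym (on-simple⇒between p p! (vertexAt-∈ p i))) ⟩
      suc (d v z + d z t)  ∎) ⟩
    suc (d v z)          ≡⟨ cong suc (vertexAt-distance p p! i) ⟩
    suc (toℕ i)          ∎
    where
      open ≡-Reasoning
      z : V
      z = vertexAt p i

  module GeodesicPoints (x y : V) where
    private
      P : x ⇝ y
      P = proj₁ (geodesic x y)
      P! : Simple P
      P! = proj₁ (proj₂ (geodesic x y))
      P≡d : len P ≡ d x y
      P≡d = proj₂ (proj₂ (geodesic x y))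

      index : ∀ i → i ≤ d x y → Fin (suc (len P))
      index i i≤d = fromℕ< (s≤s (subst (i ≤_) (sym P≡d) i≤d))

      toℕ-index : ∀ i i≤d → toℕ (index i i≤d) ≡ i
      toℕ-index i i≤d = Fin.toℕ-fromℕ< (s≤s (subst (i ≤_) (sym P≡d) i≤d))

    point : ∀ i → i ≤ d x y → V
    point i i≤d = vertexAt P (index i i≤d)

    point-from-x : ∀ i i≤d → d (point i i≤d) x ≡ i
    point-from-x i i≤d =
      trans (d-sym (point i i≤d) x) (trans (vertexAt-distance P P! (index i i≤d)) (toℕ-index i i≤d))

    point-to-y : ∀ i j i≤d → i + j ≡ d x y → d (point i i≤d) y ≡ j
    point-to-y i j i≤d i+j≡d = +-cancelˡ-≡ i _ _ (begin
      i + d v y       ≡⟨ cong (_+ d v y) (trans (sym (point-from-x i i≤d)) (d-sym v x)) ⟩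
      d x v + d v y   ≡⟨ on-simple⇒between P P! (vertexAt-∈ P (index i i≤d)) ⟩
      d x y           ≡⟨ sym i+j≡d ⟩
      i + j           ∎)
      where
        open ≡-Reasoning
        v : V
        v = point i i≤d

    point-adj : ∀ i i≤d i+1≤d → Adj G (point i i≤d) (point (suc i) i+1≤d)
    point-adj i i≤d i+1≤d = vertexAt-consecutive P (index i i≤d) (index (suc i) i+1≤d)
      (trans (toℕ-index (suc i) i+1≤d) (cong suc (sym (toℕ-index i i≤d))))

module Degrees {n : ℕ} (G : Graph n) where
  open Walks G
  open Graph G using (adj)

  neighbours⇒≤degree : ∀ {m x} (f : Fin m → V) → Injective _≡_ _≡_ f → (∀ i → Adj G x (f i)) →
                       m ≤ degree G x
  neighbours⇒≤degree {x = x} f f-inj adj-f =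
    injection⇒≤∣∣ (tabulate (adj x)) f f-inj (λ i → ∈ₛ-tabulate⁺ (adj x) (adj-f i))

  ≤degree⇒neighbours : ∀ {m x} → m ≤ degree G x →
                       Σ (Fin m → V) λ f → Injective _≡_ _≡_ f × (∀ i → Adj G x (f i))
  ≤degree⇒neighbours {x = x} m≤deg with ≤∣∣⇒injection (tabulate (adj x)) m≤deg
  ... | f , f-inj , f∈ = f , f-inj , λ i → ∈ₛ-tabulate⁻ (adj x) (f∈ i)

  pair : V → V → Fin 2 → V
  pair p q zero       = p
  pair p q (suc zero) = q

  pair-injective : ∀ {p q} → p ≢ q → Injective _≡_ _≡_ (pair p q)
  pair-injective p≢q {zero}     {zero}     _  = refl
  pair-injective p≢q {zero}     {suc zero} eq = ⊥-elim (p≢q eq)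
  pair-injective p≢q {suc zero} {zero}     eq = ⊥-elim (p≢q (sym eq))
  pair-injective p≢q {suc zero} {suc zero} _  = refl

  triple : V → V → V → Fin 3 → V
  triple p q r zero             = p
  triple p q r (suc i)          = pair q r i

  triple-injective : ∀ {p q r} → p ≢ q → p ≢ r → q ≢ r → Injective _≡_ _≡_ (triple p q r)
  triple-injective p≢q p≢r q≢r {zero}  {zero}  _  = refl
  triple-injective p≢q p≢r q≢r {zero}  {suc zero}       eq = ⊥-elim (p≢q eq)
  triple-injective p≢q p≢r q≢r {zero}  {suc (suc zero)} eq = ⊥-elim (p≢r eq)
  triple-injective p≢q p≢r q≢r {suc zero}       {zero} eq = ⊥-elim (p≢q (sym eq))
  triple-injective p≢q p≢r q≢r {suc (suc zero)} {zero} eq = ⊥-elim (p≢r (sym eq))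
  triple-injective p≢q p≢r q≢r {suc i} {suc j} eq = cong suc (pair-injective q≢r eq)

  no-third-neighbour : ∀ {x p q r} → degree G x ≤ 2 → Adj G x p → Adj G x q → p ≢ q → Adj G x r →
                       r ≡ p ⊎ r ≡ q
  no-third-neighbour {x} {p} {q} {r} deg≤2 xp xq p≢q xr with r Fin.≟ p | r Fin.≟ q
  ... | yes r≡p | _       = inj₁ r≡p
  ... | no _    | yes r≡q = inj₂ r≡q
  ... | no r≢p  | no r≢q  = ⊥-elim (<-irrefl refl (≤-trans 3≤deg deg≤2))
    where
      3≤deg : 3 ≤ degree G x
      3≤deg = neighbours⇒≤degree (triple p q r) (triple-injective p≢q (≢-sym r≢p) (≢-sym r≢q))
                λ { zero → xp ; (suc zero) → xq ; (suc (suc zero)) → xr }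

  sole-neighbour⇒degree≡1 : ∀ {x b} → Adj G x b → (∀ r → Adj G x r → r ≡ b) → degree G x ≡ 1
  sole-neighbour⇒degree≡1 {x} {b} xb sole with 2 ≤? degree G x
  ... | no deg≱2 =
    ≤-antisym (≤-pred (≰⇒> deg≱2)) (neighbours⇒≤degree (λ _ → b) (λ { {zero} {zero} _ → refl }) (λ _ → xb))
  ... | yes 2≤deg with ≤degree⇒neighbours 2≤deg
  ...   | f , f-inj , adj-f with f-inj (trans (sole _ (adj-f zero)) (sym (sole _ (adj-f (suc zero)))))
  ...     | ()

  degree≤2-cases : ∀ {x b} → degree G x ≤ 2 → Adj G x b →
    (∀ r → Adj G x r → r ≡ b) ⊎ (Σ V λ q → Adj G x q × q ≢ b × (∀ r → Adj G x r → r ≡ b ⊎ r ≡ q))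
  degree≤2-cases {x} {b} deg≤2 xb with Fin.any? (λ q → Adj? x q ×-dec ¬? (q Fin.≟ b))
  ... | yes (q , xq , q≢b) = inj₂ (q , xq , q≢b , λ r xr → no-third-neighbour deg≤2 xb xq (≢-sym q≢b) xr)
  ... | no none = inj₁ sole
    where
      sole : ∀ r → Adj G x r → r ≡ b
      sole r xr with r Fin.≟ b
      ... | yes r≡b = r≡b
      ... | no r≢b  = ⊥-elim (none (r , xr , r≢b))

  major⇒two-more : ∀ {x b} → IsMajor G x → Adj G x b →
    Σ V λ q₁ → Σ V λ q₂ → Adj G x q₁ × Adj G x q₂ × q₁ ≢ b × q₂ ≢ b × q₁ ≢ q₂
  major⇒two-more {x} {b} major xb with ≤degree⇒neighbours major
  ... | f , f-inj , adj-f with f zero Fin.≟ b | f (suc zero) Fin.≟ b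
  ... | yes refl | _        = f (suc zero) , f (suc (suc zero)) , adj-f _ , adj-f _ ,
                              injective⇒apart f-inj (λ ()) , injective⇒apart f-inj (λ ()) ,
                              injective⇒apart f-inj (λ ())
  ... | no f0≢b  | yes refl = f zero , f (suc (suc zero)) , adj-f _ , adj-f _ , f0≢b ,
                              injective⇒apart f-inj (λ ()) , injective⇒apart f-inj (λ ())
  ... | no f0≢b  | no f1≢b  = f zero , f (suc zero) , adj-f _ , adj-f _ , f0≢b , f1≢b ,
                              injective⇒apart f-inj (λ ())

-- Branches of a tree at an edge, and induction over them.

module Branches {n : ℕ} (G : Graph n) (conn : Connected G) (acyc : ¬ HasCycle G) where
  open Walks G
  open Distance G conn
  open TreeDistance G conn acyc

  -- Branch a b z: z lies on a's side of the edge a–b, i.e. in the component of a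
  -- once that edge is removed.
  Branch : V → V → V → Set
  Branch a b z = d a z < d b z

  Branch? : ∀ a b z → Dec (Branch a b z)
  Branch? a b z = d a z <? d b z

  branch-step : ∀ {a b} → Adj G a b → ∀ {z} → Branch a b z → d b z ≡ suc (d a z)
  branch-step {a} {b} ab {z} z∈ with parity ab z
  ... | inj₁ further = further
  ... | inj₂ closer  = ⊥-elim (<-asym z∈ (subst (d b z <_) (sym closer) ≤-refl))

  off-branch : ∀ {a b} → Adj G a b → ∀ {z} → ¬ Branch a b z → d a z ≡ suc (d b z)
  off-branch {a} {b} ab {z} z∉ with parity ab z
  ... | inj₁ further = ⊥-elim (z∉ (subst (d a z <_) (sym further) ≤-refl))
  ... | inj₂ closer  = closer

  off-branch⇒other : ∀ {a b} → Adj G a b → ∀ {z} → ¬ Branch a b z → Branch b a z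
  off-branch⇒other {a} {b} ab {z} z∉ = subst (d b z <_) (sym (off-branch ab z∉)) ≤-refl

  root∈branch : ∀ {a b} → Adj G a b → Branch a b a
  root∈branch {a} {b} ab = subst₂ _<_ (sym (d-refl a)) (sym (trans (d-sym b a) (d-adj ab))) (s≤s z≤n)

  other∉branch : ∀ {a b} → Adj G a b → ¬ Branch a b b
  other∉branch ab b∈ = <-asym b∈ (root∈branch (Adj-sym ab))

  -- Distances across an edge: the geodesic from one side to the other uses the edge.
  across : ∀ {a b} → Adj G a b → ∀ {z w} → Branch a b z → ¬ Branch a b w → d z w ≡ d z a + suc (d b w)
  across {a} {b} ab {z} {w} z∈ w∉ with geodesic z a | geodesic b w
  ... | g₁ , g₁! , g₁≡d | g₂ , g₂! , g₂≡d =
    trans (join g₁ ab g₂ g₁! g₂! disjoint) (cong₂ (λ l m → l + suc m) g₁≡d g₂≡d)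
    where
      z-further-from-b : d z b ≡ suc (d z a)
      z-further-from-b = trans (d-sym z b) (trans (branch-step ab z∈) (cong suc (d-sym a z)))
      w-further-from-a : d w a ≡ suc (d w b)
      w-further-from-a = trans (d-sym w a) (trans (off-branch ab w∉) (cong suc (d-sym b w)))
      disjoint : Disjoint (verts g₁) (verts g₂)
      disjoint (x∈g₁ , x∈g₂) = <-asym
        (between⇒closer (on-simple⇒between g₁ g₁! x∈g₁) z-further-from-b)
        (between⇒closer (between-sym (on-simple⇒between g₂ g₂! x∈g₂)) w-further-from-a)

  -- A vertex of the branch other than its root lies in the branch of some
  -- further neighbour r of a (the next vertex on the geodesic from a).
  branch-cases : ∀ {a b} → Adj G a b → ∀ {z} → Branch a b z →
                 z ≡ a ⊎ Σ V λ r → Adj G a r × r ≢ b × Branch r a z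
  branch-cases {a} {b} ab {z} z∈ with z Fin.≟ a | geodesic a z
  ... | yes z≡a | _ = inj₁ z≡a
  ... | no z≢a | stop , _ , _ = ⊥-elim (z≢a refl)
  ... | no z≢a | step {v = r} ar p , (_ , p!) , p≡d = inj₂ (r , ar , r≢b , r-closer)
    where
      r-closer : d r z < d a z
      r-closer = subst₂ _<_ (simple⇒shortest p p!) p≡d ≤-refl
      r≢b : r ≢ b
      r≢b refl = <-asym z∈ r-closer

  sub-branch : ∀ {a b q} → Adj G a b → Adj G a q → q ≢ b → ∀ {z} → Branch q a z → Branch a b z
  sub-branch {a} {b} {q} ab aq q≢b {z} z∈ = subst₂ _<_ (sym via-q) (sym via-a) (n<1+n (suc (d q z)))
    where
      b∉ : ¬ Branch q a b
      b∉ b∈ = q≢b (d≡0⇒≡ (n≤0⇒n≡0 (≤-pred (subst (d q b <_) (d-adj ab) b∈))))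
      via-q : d a z ≡ suc (d q z)
      via-q = branch-step (Adj-sym aq) z∈
      via-a : d b z ≡ suc (suc (d q z))
      via-a = begin
        d b z                   ≡⟨ d-sym b z ⟩
        d z b                   ≡⟨ across (Adj-sym aq) z∈ b∉ ⟩
        d z q + suc (d a b)     ≡⟨ cong (λ m → d z q + suc m) (d-adj ab) ⟩
        d z q + 2               ≡⟨ +-comm (d z q) 2 ⟩
        suc (suc (d z q))       ≡⟨ cong (λ m → suc (suc m)) (d-sym z q) ⟩
        suc (suc (d q z))       ∎
        where open ≡-Reasoning

  siblings-disjoint : ∀ {w q₁ q₂} → Adj G w q₁ → Adj G w q₂ → q₁ ≢ q₂ → ∀ {z} → Branch q₁ w z → ¬ Branch q₂ w z
  siblings-disjoint wq₁ wq₂ q₁≢q₂ z∈₁ z∈₂ = <-asym (sub-branch wq₂ wq₁ q₁≢q₂ z∈₁) z∈₂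

  size : V → V → ℕ
  size a b = ∣ subsetOf (Branch? a b) ∣

  size-shrinks : ∀ {a b q} → Adj G a b → Adj G a q → q ≢ b → size q a < size a b
  size-shrinks {a} {b} {q} ab aq q≢b = p⊂q⇒∣p∣<∣q∣
    ((λ z∈ → ∈subsetOf⁺ (Branch? a b) (sub-branch ab aq q≢b (∈subsetOf⁻ (Branch? q a) z∈))) ,
     a , ∈subsetOf⁺ (Branch? a b) (root∈branch ab) ,
     λ a∈ → other∉branch (Adj-sym aq) (∈subsetOf⁻ (Branch? q a) a∈))

  branch-induction : (P : V → V → Set) →
    (∀ {a b} → Adj G a b → (∀ {q} → Adj G a q → q ≢ b → P q a) → P a b) →
    ∀ {a b} → Adj G a b → P a b
  branch-induction P extend {a} {b} ab = <-rec Q go (size a b) refl ab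
    where
      Q : ℕ → Set
      Q N = ∀ {a b} → size a b ≡ N → Adj G a b → P a b
      go : ∀ N → (∀ {M} → M < N → Q M) → Q N
      go N smaller refl ab = extend ab (λ aq q≢b → smaller (size-shrinks ab aq q≢b) refl (Adj-sym aq))

-- Legs: branches without major vertices, their ends, and terminal vertices.

module Legs {n : ℕ} (G : Graph n) (conn : Connected G) (acyc : ¬ HasCycle G) where
  open Walks G
  open Distance G conn
  open Branches G conn acyc
  open Degrees G

  Leg : V → V → Set
  Leg a b = ∀ z → Branch a b z → degree G z ≤ 2

  LegEnd : V → V → V → Set
  LegEnd a b l = Branch a b l × degree G l ≡ 1 × (∀ z → Branch a b z → d a z + d z l ≡ d a l)

  leg-end : ∀ {a b} → Adj G a b → Leg a b → Σ V (LegEnd a b)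
  leg-end = branch-induction (λ a b → Leg a b → Σ V (LegEnd a b)) extend
    where
      extend : ∀ {a b} → Adj G a b → (∀ {q} → Adj G a q → q ≢ b → Leg q a → Σ V (LegEnd q a)) →
               Leg a b → Σ V (LegEnd a b)
      extend {a} {b} ab ih leg with degree≤2-cases (leg a (root∈branch ab)) ab
      -- a is a leaf: the branch is just {a}
      ... | inj₁ sole = a , root∈branch ab , sole-neighbour⇒degree≡1 ab sole , only-a
        where
          only-a : ∀ z → Branch a b z → d a z + d z a ≡ d a a
          only-a z z∈ with branch-cases ab z∈
          ... | inj₁ refl = cong (_+ d a a) (d-refl a)
          ... | inj₂ (r , ar , r≢b , _) = ⊥-elim (r≢b (sole r ar))
      -- a has one further neighbour q: extend the leg end of the branch at q
      ... | inj₂ (q , aq , q≢b , only-b-q) with ih aq q≢b (λ z z∈ → leg z (sub-branch ab aq q≢b z∈))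
      ...   | l , l∈ , leaf , q-l-between = l , sub-branch ab aq q≢b l∈ , leaf , a-l-between
        where
          a-l-between : ∀ z → Branch a b z → d a z + d z l ≡ d a l
          a-l-between z z∈ with branch-cases ab z∈
          ... | inj₁ refl = cong (_+ d a l) (d-refl a)
          ... | inj₂ (r , ar , r≢b , z∈r) with only-b-q r ar
          ...   | inj₁ r≡b = ⊥-elim (r≢b r≡b)
          ...   | inj₂ refl = begin
            d a z + d z l         ≡⟨ cong (_+ d z l) (branch-step (Adj-sym aq) z∈r) ⟩
            suc (d q z + d z l)   ≡⟨ cong suc (q-l-between z z∈r) ⟩
            suc (d q l)           ≡⟨ sym (branch-step (Adj-sym aq) l∈) ⟩
            d a l                 ∎
            where open ≡-Reasoning

  leg-extend : ∀ {a b} → Adj G a b → degree G a ≤ 2 → (∀ {r} → Adj G a r → r ≢ b → Leg r a) → Leg a b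
  leg-extend ab a-minor legs z z∈ with branch-cases ab z∈
  ... | inj₁ refl = a-minor
  ... | inj₂ (r , ar , r≢b , z∈r) = legs ar r≢b z z∈r

  -- Terminality with the distances made explicit; in this form it is decidable.
  Terminal : V → V → Set
  Terminal v u = IsMajor G v × degree G u ≡ 1 × (∀ w → IsMajor G w → w ≢ v → d u v < d u w)

  Terminal⇒IsTerminal : ∀ {v u} → Terminal v u → IsTerminal G v u
  Terminal⇒IsTerminal (major , leaf , closest) = major , leaf , λ w major-w w≢v d₁ d₂ D₁ D₂ →
    subst₂ _<_ (sym (Dist⇒≡d D₁)) (sym (Dist⇒≡d D₂)) (closest w major-w w≢v)

  IsTerminal⇒Terminal : ∀ {v u} → IsTerminal G v u → Terminal v u
  IsTerminal⇒Terminal {v} {u} (major , leaf , closest) = major , leaf , λ w major-w w≢v →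
    closest w major-w w≢v _ _ (Dist-d u v) (Dist-d u w)

  isTerminal? : ∀ v u → Dec (IsTerminal G v u)
  isTerminal? v u = map′ Terminal⇒IsTerminal IsTerminal⇒Terminal
    ((3 ≤? degree G v) ×-dec ((degree G u ≟ 1) ×-dec
      Fin.all? (λ w → (3 ≤? degree G w) →-dec (¬? (w Fin.≟ v) →-dec (d u v <? d u w)))))

  -- The end of a leg at a major vertex w is a terminal vertex of w: every other major
  -- vertex lies outside the leg, hence beyond w.
  leg-end-terminal : ∀ {w q l} → IsMajor G w → Adj G w q → Leg q w → LegEnd q w l → IsTerminal G w l
  leg-end-terminal {w} {q} {l} major wq leg (l∈ , leaf , _) = Terminal⇒IsTerminal (major , leaf , closest)
    where
      closest : ∀ w' → IsMajor G w' → w' ≢ w → d l w < d l w'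
      closest w' major' w'≢w = begin-strict
        d l w                  ≡⟨ across (Adj-sym wq) l∈ (other∉branch (Adj-sym wq)) ⟩
        d l q + suc (d w w)    ≡⟨ cong (λ m → d l q + suc m) (d-refl w) ⟩
        d l q + 1              <⟨ +-monoʳ-< (d l q) (s≤s (d-pos (λ w≡w' → w'≢w (sym w≡w')))) ⟩
        d l q + suc (d w w')   ≡⟨ sym (across (Adj-sym wq) l∈ w'∉leg) ⟩
        d l w'                 ∎
        where
          open ≤-Reasoning
          w'∉leg : ¬ Branch q w w'
          w'∉leg w'∈ = <-irrefl refl (≤-trans major' (leg w' w'∈))

  leg-between : ∀ {a b la lb} → Adj G a b → LegEnd a b la → ¬ Branch a b lb →
                ∀ z → Branch a b z → d lb z + d z la ≡ d lb la
  leg-between {a} {b} {la} {lb} ab (la∈ , _ , a-la-between) lb∉ z z∈ = begin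
    d lb z + d z la                ≡⟨ cong (_+ d z la) (via-edge z∈) ⟩
    (d lb b + suc (d a z)) + d z la ≡⟨ +-assoc (d lb b) (suc (d a z)) (d z la) ⟩
    d lb b + suc (d a z + d z la)  ≡⟨ cong (λ m → d lb b + suc m) (a-la-between z z∈) ⟩
    d lb b + suc (d a la)          ≡⟨ sym (via-edge la∈) ⟩
    d lb la                        ∎
    where
      open ≡-Reasoning
      via-edge : ∀ {v} → Branch a b v → d lb v ≡ d lb b + suc (d a v)
      via-edge v∈ = across (Adj-sym ab) (off-branch⇒other ab lb∉) (λ v∈' → <-asym v∈ v∈')

  two-terminals⇒ℳ : ∀ {w l₁ l₂} → IsMajor G w → IsTerminal G w l₁ → IsTerminal G w l₂ → l₁ ≢ l₂ → InM G w
  two-terminals⇒ℳ {w} {l₁} {l₂} major terminal₁ terminal₂ l₁≢l₂ =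
    major , _ , hasCard-subsetOf G (isTerminal? w) ,
    injection⇒≤∣∣ _ (pair l₁ l₂) (pair-injective l₁≢l₂)
      (λ { zero → ∈subsetOf⁺ (isTerminal? w) terminal₁ ; (suc zero) → ∈subsetOf⁺ (isTerminal? w) terminal₂ })

module PathGraphs {n : ℕ} (G : Graph n) (conn : Connected G) (acyc : ¬ HasCycle G) where
  open Walks G
  open Distance G conn
  open TreeDistance G conn acyc
  open Branches G conn acyc
  open Legs G conn acyc

  -- If every vertex lies between l₁ and l₂, then the geodesic from l₁ to l₂ runs
  -- through all vertices and its numbering exhibits G as a path graph.
  all-between⇒path : ∀ {l₁ l₂} → (∀ z → d l₁ z + d z l₂ ≡ d l₁ l₂) → IsPathGraph G
  all-between⇒path {l₁} {l₂} all with geodesic l₁ l₂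
  ... | P , P! , _ = f , f-inj , λ i j → mk⇔ (adjacent⇒consecutive i j) (consecutive⇒adjacent i j)
    where
      onto : ∀ z → ∃ λ i → vertexAt P i ≡ z
      onto z = ∈⇒vertexAt P (between⇒on-simple (all z) P P!)
      P-length : suc (len P) ≡ n
      P-length = ≤-antisym (Fin.injective⇒≤ (vertexAt-injective P P!))
                           (image⊆⇒≤ (λ z → z) (vertexAt P) (λ eq → eq) onto)
      c : Fin n → Fin (suc (len P))
      c = cast (sym P-length)
      toℕ-c : ∀ i → toℕ (c i) ≡ toℕ i
      toℕ-c = Fin.toℕ-cast (sym P-length)
      f : Fin n → Fin n
      f i = vertexAt P (c i)
      f-inj : Injective _≡_ _≡_ f
      f-inj {i} {j} eq =
        Fin.toℕ-injective (trans (sym (toℕ-c i)) (trans (cong toℕ (vertexAt-injective P P! eq)) (toℕ-c j)))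
      position : ∀ i → d (f i) l₁ ≡ toℕ i
      position i = trans (d-sym (f i) l₁) (trans (vertexAt-distance P P! (c i)) (toℕ-c i))
      adjacent⇒consecutive : ∀ i j → Adj G (f i) (f j) → toℕ i ≡ suc (toℕ j) ⊎ toℕ j ≡ suc (toℕ i)
      adjacent⇒consecutive i j fi~fj with parity fi~fj l₁
      ... | inj₁ further = inj₂ (trans (sym (position j)) (trans further (cong suc (position i))))
      ... | inj₂ closer  = inj₁ (trans (sym (position i)) (trans closer (cong suc (position j))))
      consecutive⇒adjacent : ∀ i j → toℕ i ≡ suc (toℕ j) ⊎ toℕ j ≡ suc (toℕ i) → Adj G (f i) (f j)
      consecutive⇒adjacent i j (inj₁ i≡j+1) =
        Adj-sym (vertexAt-consecutive P (c j) (c i) (trans (toℕ-c i) (trans i≡j+1 (cong suc (sym (toℕ-c j))))))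
      consecutive⇒adjacent i j (inj₂ j≡i+1) =
        vertexAt-consecutive P (c i) (c j) (trans (toℕ-c j) (trans j≡i+1 (cong suc (sym (toℕ-c i)))))

  legs⇒path : ∀ {a b} → Adj G a b → Leg a b → Leg b a → IsPathGraph G
  legs⇒path {a} {b} ab leg-a leg-b with leg-end ab leg-a | leg-end (Adj-sym ab) leg-b
  ... | la , end-a | lb , end-b = all-between⇒path all-between
    where
      all-between : ∀ z → d lb z + d z la ≡ d lb la
      all-between z with Branch? a b z
      ... | yes z∈a = leg-between ab end-a (λ lb∈a → <-asym (proj₁ end-b) lb∈a) z z∈a
      ... | no z∉a = between-sym (leg-between (Adj-sym ab) end-b (λ la∈b → <-asym (proj₁ end-a) la∈b) z
                                   (off-branch⇒other ab z∉a))

module Distinguishing {n : ℕ} (G : Graph n) (conn : Connected G) (acyc : ¬ HasCycle G) where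
  open Walks G
  open Distance G conn
  open Branches G conn acyc
  open Legs G conn acyc

  near-side : ∀ {a b x y} → Adj G a b → ¬ Branch a b y → d a x ≤ d b y → ∀ {z} → Branch a b z → d x z < d y z
  near-side {a} {b} {x} {y} ab y∉ ax≤by {z} z∈ = begin-strict
    d x z               ≡⟨ d-sym x z ⟩
    d z x               ≤⟨ d-triangle z a x ⟩
    d z a + d a x       <⟨ +-monoʳ-< (d z a) (s≤s ax≤by) ⟩
    d z a + suc (d b y) ≡⟨ sym (across ab z∈ y∉) ⟩
    d z y               ≡⟨ d-sym z y ⟩
    d y z               ∎
    where open ≤-Reasoning

  near-side-distinguishes : ∀ {a b x y} → Adj G a b → ¬ Branch a b y → d a x ≤ d b y →
                            ∀ {z} → Branch a b z → Distinguishes G x y z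
  near-side-distinguishes ab y∉ ax≤by z∈ = distinguishes (<⇒≢ (near-side ab y∉ ax≤by z∈))

  neighbours-distinguished⁺ : ∀ {w q₁ q₂} → Adj G w q₁ → Adj G w q₂ → q₁ ≢ q₂ →
                              ∀ {z} → Branch q₁ w z ⊎ Branch q₂ w z → Distinguishes G q₁ q₂ z
  neighbours-distinguished⁺ wq₁ wq₂ q₁≢q₂ (inj₁ z∈₁) =
    distinguishes (<⇒≢ (<-trans z∈₁ (sub-branch wq₂ wq₁ q₁≢q₂ z∈₁)))
  neighbours-distinguished⁺ wq₁ wq₂ q₁≢q₂ (inj₂ z∈₂) =
    distinguishes (≢-sym (<⇒≢ (<-trans z∈₂ (sub-branch wq₁ wq₂ (≢-sym q₁≢q₂) z∈₂))))

  neighbours-distinguished⁻ : ∀ {w q₁ q₂} → Adj G w q₁ → Adj G w q₂ →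
                              ∀ {z} → Distinguishes G q₁ q₂ z → Branch q₁ w z ⊎ Branch q₂ w z
  neighbours-distinguished⁻ {w} {q₁} {q₂} wq₁ wq₂ {z} dist with Branch? q₁ w z | Branch? q₂ w z
  ... | yes z∈₁ | _       = inj₁ z∈₁
  ... | no _    | yes z∈₂ = inj₂ z∈₂
  ... | no z∉₁  | no z∉₂  = ⊥-elim (distinguishes⁻ dist
                              (trans (off-branch (Adj-sym wq₁) z∉₁) (sym (off-branch (Adj-sym wq₂) z∉₂))))

  legs-between⁺ : ∀ {w q₁ q₂ l₁ l₂} → Adj G w q₁ → Adj G w q₂ → q₁ ≢ q₂ → LegEnd q₁ w l₁ → LegEnd q₂ w l₂ →
                  ∀ {z} → Branch q₁ w z ⊎ Branch q₂ w z → d l₁ z + d z l₂ ≡ d l₁ l₂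
  legs-between⁺ wq₁ wq₂ q₁≢q₂ end₁ end₂ {z} (inj₁ z∈₁) =
    between-sym (leg-between (Adj-sym wq₁) end₁ (siblings-disjoint wq₂ wq₁ (≢-sym q₁≢q₂) (proj₁ end₂)) z z∈₁)
  legs-between⁺ wq₁ wq₂ q₁≢q₂ end₁ end₂ {z} (inj₂ z∈₂) =
    leg-between (Adj-sym wq₂) end₂ (siblings-disjoint wq₁ wq₂ q₁≢q₂ (proj₁ end₁)) z z∈₂

  legs-between⁻ : ∀ {w q₁ q₂ l₁ l₂} → Adj G w q₁ → Adj G w q₂ → q₁ ≢ q₂ → LegEnd q₁ w l₁ → LegEnd q₂ w l₂ →
                  ∀ {v} → d l₁ v + d v l₂ ≡ d l₁ l₂ → v ≡ w ⊎ (Branch q₁ w v ⊎ Branch q₂ w v)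
  legs-between⁻ {w} {q₁} {q₂} {l₁} {l₂} wq₁ wq₂ q₁≢q₂ (l₁∈ , _) (l₂∈ , _) {v} between
    with Branch? q₁ w v | Branch? q₂ w v
  ... | yes v∈₁ | _       = inj₂ (inj₁ v∈₁)
  ... | no _    | yes v∈₂ = inj₂ (inj₂ v∈₂)
  ... | no v∉₁  | no v∉₂  = inj₁ (sym (d≡0⇒≡ (detour-free (d l₁ q₁) (d l₂ q₂) (d w v) detour)))
    where
      open ≡-Reasoning
      l₂∉₁ : ¬ Branch q₁ w l₂
      l₂∉₁ = siblings-disjoint wq₂ wq₁ (≢-sym q₁≢q₂) l₂∈
      -- going from l₁ to l₂ via v costs twice the distance from w to v extra
      detour : (d l₁ q₁ + suc (d w v)) + (d l₂ q₂ + suc (d w v)) ≡ d l₁ q₁ + suc (suc (d l₂ q₂))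
      detour = begin
        (d l₁ q₁ + suc (d w v)) + (d l₂ q₂ + suc (d w v))
          ≡⟨ sym (cong₂ _+_ (across (Adj-sym wq₁) l₁∈ v∉₁)
                            (trans (d-sym v l₂) (across (Adj-sym wq₂) l₂∈ v∉₂))) ⟩
        d l₁ v + d v l₂
          ≡⟨ between ⟩
        d l₁ l₂
          ≡⟨ across (Adj-sym wq₁) l₁∈ l₂∉₁ ⟩
        d l₁ q₁ + suc (d w l₂)
          ≡⟨ cong (λ m → d l₁ q₁ + suc m) (trans (branch-step (Adj-sym wq₂) l₂∈) (cong suc (d-sym q₂ l₂))) ⟩
        d l₁ q₁ + suc (suc (d l₂ q₂))
          ∎

module KeyLemma {n : ℕ} (G : Graph n) (conn : Connected G) (acyc : ¬ HasCycle G) (k : ℕ)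
                (hyp : ∀ (w : Fin n) → InM G w → Ter G w 2 × Varsigma G w k) where
  open Walks G
  open Distance G conn
  open TreeDistance G conn acyc
  open Branches G conn acyc
  open Degrees G
  open Legs G conn acyc
  open PathGraphs G conn acyc
  open Distinguishing G conn acyc

  Good : (V → Set) → Set
  Good X = AtLeast G (λ z → InDk G k z × X z) k

  Good-mono : ∀ {X Y : V → Set} → (∀ {z} → X z → Y z) → Good X → Good Y
  Good-mono {X} {Y} X⊆Y = AtLeast-mono G {P = λ z → InDk G k z × X z} {Q = λ z → InDk G k z × Y z}
                             (λ (z∈Dk , z∈X) → z∈Dk , X⊆Y z∈X)

  -- A path of length k through w joining the ends of two legs at w: the vertices
  -- distinguishing the roots q₁, q₂ of the legs are the k vertices of this path other
  -- than w, so they all belong to 𝒟_k.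
  legs-path-good : ∀ {w q₁ q₂ l₁ l₂} → Adj G w q₁ → Adj G w q₂ → q₁ ≢ q₂ →
                   LegEnd q₁ w l₁ → LegEnd q₂ w l₂ → PathVia G l₁ w l₂ k →
                   Good (λ z → Branch q₁ w z ⊎ Branch q₂ w z)
  legs-path-good {w} {q₁} {q₂} wq₁ wq₂ q₁≢q₂ end₁ end₂ Path@(f , _ , f-inj , j , fj≡w)
    with fromPathVia Path
  ... | p , p! , verts≡f = good card
    where
      in-branches : ∀ {z} → Distinguishes G q₁ q₂ z → Branch q₁ w z ⊎ Branch q₂ w z
      in-branches = neighbours-distinguished⁻ wq₁ wq₂
      on-path : ∀ i → f i ∈ verts p
      on-path i = subst (f i ∈_) (sym verts≡f) (∈-tabulate⁺ {f = f} i)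
      path-vertex : ∀ {z} → z ∈ verts p → ∃ λ i → f i ≡ z
      path-vertex {z} z∈ with ∈-tabulate⁻ {f = f} (subst (z ∈_) verts≡f z∈)
      ... | i , z≡fi = i , sym z≡fi
      others-distinguish : ∀ i → i ≢ j → Distinguishes G q₁ q₂ (f i)
      others-distinguish i i≢j with legs-between⁻ wq₁ wq₂ q₁≢q₂ end₁ end₂ (on-simple⇒between p p! (on-path i))
      ... | inj₁ fi≡w = ⊥-elim (i≢j (f-inj (trans fi≡w (sym fj≡w))))
      ... | inj₂ fi∈ = neighbours-distinguished⁺ wq₁ wq₂ q₁≢q₂ fi∈
      distinguishers-on-path : ∀ {z} → Distinguishes G q₁ q₂ z → ∃ λ i → f i ≡ z
      distinguishers-on-path dist = path-vertex
        (between⇒on-simple (legs-between⁺ wq₁ wq₂ q₁≢q₂ end₁ end₂ (in-branches dist)) p p!)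
      w-indistinct : ¬ Distinguishes G q₁ q₂ (f j)
      w-indistinct dist with in-branches dist
      ... | inj₁ w∈₁ = other∉branch (Adj-sym wq₁) (subst (Branch q₁ w) fj≡w w∈₁)
      ... | inj₂ w∈₂ = other∉branch (Adj-sym wq₂) (subst (Branch q₂ w) fj≡w w∈₂)
      card : HasCard G (Distinguishes G q₁ q₂) k
      card = hasCard-punch G f f-inj j others-distinguish distinguishers-on-path w-indistinct
      good : HasCard G (Distinguishes G q₁ q₂) k → Good (λ z → Branch q₁ w z ⊎ Branch q₂ w z)
      good (g , g-inj , g-dist , _) =
        g , g-inj , λ i → (q₁ , q₂ , q₁≢q₂ , card , g-dist i) , in-branches (g-dist i)

  -- Two legs at a major vertex w: their ends are terminal vertices of w, so w ∈ ℳ(T);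
  -- by hypothesis they are its only terminal vertices and ς(w) = k provides the path
  -- needed by legs-path-good.
  two-legs-good : ∀ {w q₁ q₂} → IsMajor G w → Adj G w q₁ → Adj G w q₂ → q₁ ≢ q₂ → Leg q₁ w → Leg q₂ w →
                  Good (λ z → Branch q₁ w z ⊎ Branch q₂ w z)
  two-legs-good {w} {q₁} {q₂} major wq₁ wq₂ q₁≢q₂ leg₁ leg₂
    with leg-end (Adj-sym wq₁) leg₁ | leg-end (Adj-sym wq₂) leg₂
  ... | l₁ , end₁ | l₂ , end₂ = via-ς (hyp w (two-terminals⇒ℳ major terminal₁ terminal₂ l₁≢l₂))
    where
      l₁≢l₂ : l₁ ≢ l₂
      l₁≢l₂ refl = siblings-disjoint wq₁ wq₂ q₁≢q₂ (proj₁ end₁) (proj₁ end₂)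
      terminal₁ : IsTerminal G w l₁
      terminal₁ = leg-end-terminal major wq₁ leg₁ end₁
      terminal₂ : IsTerminal G w l₂
      terminal₂ = leg-end-terminal major wq₂ leg₂ end₂
      via-ς : Ter G w 2 × Varsigma G w k → Good (λ z → Branch q₁ w z ⊎ Branch q₂ w z)
      via-ς (ter≡2 , (u , u' , terminal-u , terminal-u' , u≢u' , (Path , _)) , _)
        with hasCard-2 G ter≡2 terminal₁ terminal₂ l₁≢l₂ terminal-u
           | hasCard-2 G ter≡2 terminal₁ terminal₂ l₁≢l₂ terminal-u'
      ... | inj₁ refl | inj₁ refl = ⊥-elim (u≢u' refl)
      ... | inj₂ refl | inj₂ refl = ⊥-elim (u≢u' refl)
      ... | inj₁ refl | inj₂ refl = legs-path-good wq₁ wq₂ q₁≢q₂ end₁ end₂ Path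
      ... | inj₂ refl | inj₁ refl =
        Good-mono {X = λ z → Branch q₂ w z ⊎ Branch q₁ w z}
          (λ { (inj₁ z∈₂) → inj₂ z∈₂ ; (inj₂ z∈₁) → inj₁ z∈₁ })
          (legs-path-good wq₂ wq₁ (≢-sym q₁≢q₂) end₂ end₁ Path)

  -- Every branch either contains k vertices of 𝒟_k or is a leg: descend through the
  -- branch; the first major vertex all of whose further branches are legs provides the
  -- k vertices by two-legs-good.
  good-or-leg : ∀ {a b} → Adj G a b → Good (Branch a b) ⊎ Leg a b
  good-or-leg = branch-induction (λ a b → Good (Branch a b) ⊎ Leg a b) extend
    where
      extend : ∀ {a b} → Adj G a b → (∀ {q} → Adj G a q → q ≢ b → Good (Branch q a) ⊎ Leg q a) →
               Good (Branch a b) ⊎ Leg a b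
      extend {a} {b} ab ih with 3 ≤? degree G a
      ... | yes major with major⇒two-more major ab
      ...   | q₁ , q₂ , aq₁ , aq₂ , q₁≢b , q₂≢b , q₁≢q₂ with ih aq₁ q₁≢b | ih aq₂ q₂≢b
      ...     | inj₁ good | _         =
        inj₁ (Good-mono {X = Branch q₁ a} {Y = Branch a b} (sub-branch ab aq₁ q₁≢b) good)
      ...     | inj₂ _    | inj₁ good =
        inj₁ (Good-mono {X = Branch q₂ a} {Y = Branch a b} (sub-branch ab aq₂ q₂≢b) good)
      ...     | inj₂ leg₁ | inj₂ leg₂ =
        inj₁ (Good-mono {Y = Branch a b} [ sub-branch ab aq₁ q₁≢b , sub-branch ab aq₂ q₂≢b ]′
               (two-legs-good major aq₁ aq₂ q₁≢q₂ leg₁ leg₂))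
      extend {a} {b} ab ih | no not-major = minor (≤-pred (≰⇒> not-major))
        where
          minor : degree G a ≤ 2 → Good (Branch a b) ⊎ Leg a b
          minor a-minor with degree≤2-cases a-minor ab
          ... | inj₁ sole = inj₂ (leg-extend ab a-minor λ ar r≢b → ⊥-elim (r≢b (sole _ ar)))
          ... | inj₂ (q , aq , q≢b , only-b-q) with ih aq q≢b
          ...   | inj₁ good = inj₁ (Good-mono {X = Branch q a} {Y = Branch a b} (sub-branch ab aq q≢b) good)
          ...   | inj₂ leg  = inj₂ (leg-extend ab a-minor legs)
            where
              legs : ∀ {r} → Adj G a r → r ≢ b → Leg r a
              legs ar r≢b with only-b-q _ ar
              ... | inj₁ r≡b = ⊥-elim (r≢b r≡b)
              ... | inj₂ refl = leg

  module _ (not-path : ¬ IsPathGraph G) where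

    -- d x y = 2h + 1: the middle edge a–b of the geodesic has x and y on opposite
    -- sides at distance h; one of its two branches is good, else T would be a path.
    odd-distance-good : ∀ {x y} h → d x y ≡ h + suc h → Good (Distinguishes G x y)
    odd-distance-good {x} {y} h dxy≡ = conclude (good-or-leg ab) (good-or-leg (Adj-sym ab))
      where
        open GeodesicPoints x y
        h≤d : h ≤ d x y
        h≤d = subst (h ≤_) (sym dxy≡) (m≤m+n h (suc h))
        h+1≤d : suc h ≤ d x y
        h+1≤d = subst (suc h ≤_) (sym dxy≡) (m≤n+m (suc h) h)
        a b : V
        a = point h h≤d
        b = point (suc h) h+1≤d
        ab : Adj G a b
        ab = point-adj h h≤d h+1≤d
        a-x : d a x ≡ h
        a-x = point-from-x h h≤d
        a-y : d a y ≡ suc h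
        a-y = point-to-y h (suc h) h≤d (sym dxy≡)
        b-x : d b x ≡ suc h
        b-x = point-from-x (suc h) h+1≤d
        b-y : d b y ≡ h
        b-y = point-to-y (suc h) h h+1≤d (sym (trans dxy≡ (+-suc h h)))
        a-side : ∀ {z} → Branch a b z → Distinguishes G x y z
        a-side = near-side-distinguishes ab (λ y∈ → <-asym (subst₂ _<_ a-y b-y y∈) (n<1+n h))
                   (≤-reflexive (trans a-x (sym b-y)))
        b-side : ∀ {z} → Branch b a z → Distinguishes G x y z
        b-side z∈ = distinguishes-sym (near-side-distinguishes (Adj-sym ab)
                      (λ x∈ → <-asym (subst₂ _<_ b-x a-x x∈) (n<1+n h)) (≤-reflexive (trans b-y (sym a-x))) z∈)
        conclude : Good (Branch a b) ⊎ Leg a b → Good (Branch b a) ⊎ Leg b a → Good (Distinguishes G x y)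
        conclude (inj₁ good) _ = Good-mono {X = Branch a b} a-side good
        conclude (inj₂ _) (inj₁ good) = Good-mono {X = Branch b a} b-side good
        conclude (inj₂ leg-a) (inj₂ leg-b) = ⊥-elim (not-path (legs⇒path ab leg-a leg-b))

    -- d x y = 2h + 2: around the middle vertex c of the geodesic, with neighbours a
    -- towards x and b towards y, either a branch is good, or both are legs and c is
    -- major (two-legs-good applies), or T is a path.
    even-distance-good : ∀ {x y} h → d x y ≡ suc h + suc h → Good (Distinguishes G x y)
    even-distance-good {x} {y} h dxy≡ = conclude (good-or-leg ac) (good-or-leg (Adj-sym cb))
      where
        open GeodesicPoints x y
        h≤d : h ≤ d x y
        h≤d = subst (h ≤_) (sym dxy≡) (≤-trans (n≤1+n h) (m≤m+n (suc h) (suc h)))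
        h+1≤d : suc h ≤ d x y
        h+1≤d = subst (suc h ≤_) (sym dxy≡) (m≤m+n (suc h) (suc h))
        h+2≤d : suc (suc h) ≤ d x y
        h+2≤d = subst (suc (suc h) ≤_) (sym dxy≡) (s≤s (m≤n+m (suc h) h))
        a c b : V
        a = point h h≤d
        c = point (suc h) h+1≤d
        b = point (suc (suc h)) h+2≤d
        ac : Adj G a c
        ac = point-adj h h≤d h+1≤d
        cb : Adj G c b
        cb = point-adj (suc h) h+1≤d h+2≤d
        a-x : d a x ≡ h
        a-x = point-from-x h h≤d
        a-y : d a y ≡ suc (suc h)
        a-y = point-to-y h (suc (suc h)) h≤d (sym (trans dxy≡ (sym (+-suc h (suc h)))))
        c-x : d c x ≡ suc h
        c-x = point-from-x (suc h) h+1≤d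
        c-y : d c y ≡ suc h
        c-y = point-to-y (suc h) (suc h) h+1≤d (sym dxy≡)
        b-x : d b x ≡ suc (suc h)
        b-x = point-from-x (suc (suc h)) h+2≤d
        b-y : d b y ≡ h
        b-y = point-to-y (suc (suc h)) h h+2≤d (sym (trans dxy≡ (cong suc (+-suc h h))))
        y∉a : ¬ Branch a c y
        y∉a y∈ = <-asym (subst₂ _<_ a-y c-y y∈) (n<1+n (suc h))
        x∉b : ¬ Branch b c x
        x∉b x∈ = <-asym (subst₂ _<_ b-x c-x x∈) (n<1+n (suc h))
        a-side : ∀ {z} → Branch a c z → Distinguishes G x y z
        a-side = near-side-distinguishes ac y∉a (subst₂ _≤_ (sym a-x) (sym c-y) (n≤1+n h))
        b-side : ∀ {z} → Branch b c z → Distinguishes G x y z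
        b-side z∈ = distinguishes-sym
          (near-side-distinguishes (Adj-sym cb) x∉b (subst₂ _≤_ (sym b-y) (sym c-x) (n≤1+n h)) z∈)
        a≢b : a ≢ b
        a≢b a≡b = <-irrefl (trans (sym a-x) (trans (cong (λ v → d v x) a≡b) b-x)) (n≤1+n (suc h))
        conclude : Good (Branch a c) ⊎ Leg a c → Good (Branch b c) ⊎ Leg b c → Good (Distinguishes G x y)
        conclude (inj₁ good) _ = Good-mono {X = Branch a c} a-side good
        conclude (inj₂ _) (inj₁ good) = Good-mono {X = Branch b c} b-side good
        conclude (inj₂ leg-a) (inj₂ leg-b) with 3 ≤? degree G c
        ... | yes major = Good-mono {X = λ z → Branch a c z ⊎ Branch b c z} [ a-side , b-side ]′
                            (two-legs-good major (Adj-sym ac) cb a≢b leg-a leg-b)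
        ... | no not-major = ⊥-elim (not-path (legs⇒path ac leg-a (leg-extend (Adj-sym ac) c-minor only-b)))
          where
            c-minor : degree G c ≤ 2
            c-minor = ≤-pred (≰⇒> not-major)
            only-b : ∀ {r} → Adj G c r → r ≢ a → Leg r c
            only-b cr r≢a with no-third-neighbour c-minor (Adj-sym ac) cb a≢b cr
            ... | inj₁ r≡a = ⊥-elim (r≢a r≡a)
            ... | inj₂ refl = leg-b

    every-pair-good : ∀ x y → x ≢ y → Good (Distinguishes G x y)
    every-pair-good x y x≢y with halve (d x y)
    ... | h     , inj₂ odd     = odd-distance-good h odd
    ... | zero  , inj₁ d≡0     = ⊥-elim (x≢y (d≡0⇒≡ d≡0))
    ... | suc h , inj₁ even    = even-distance-good h even

module Generators {n : ℕ} (G : Graph n) (conn : Connected G) (k : ℕ) where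
  open Distance G conn

  hasCard? : ∀ x y → Dec (HasCard G (Distinguishes G x y) k)
  hasCard? x y with ∣ subsetOf (distinguishes? x y) ∣ ≟ k
  ... | yes refl = yes (hasCard-subsetOf G (distinguishes? x y))
  ... | no ≢k    = no λ card → ≢k (hasCard-unique G (hasCard-subsetOf G (distinguishes? x y)) card)

  inDk? : ∀ z → Dec (InDk G k z)
  inDk? z = Fin.any? λ x → Fin.any? λ y → ¬? (x Fin.≟ y) ×-dec (hasCard? x y ×-dec distinguishes? x y z)

  Dk : Subset n
  Dk = subsetOf inDk?

  -- Every k-metric generator contains 𝒟_k: if |𝒟(x,y)| = k, a generator must
  -- contain k of these k vertices, i.e. all of them.
  generator⊇Dk : ∀ S → IsKMetricGenerator G k S → ∀ {z} → InDk G k z → z ∈ₛ S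
  generator⊇Dk S generator {z} (x , y , x≢y , (f , f-inj , _ , f-onto) , z∈) with generator x y x≢y
  ... | a , a-inj , a∈ with f-onto _ z∈
  ...   | i , fi≡z = subst (_∈ₛ S) aj≡z (proj₁ (a∈ j))
    where
      index : Fin k → Fin k
      index i = proj₁ (f-onto (a i) (proj₂ (a∈ i)))
      index-correct : ∀ i → f (index i) ≡ a i
      index-correct i = proj₂ (f-onto (a i) (proj₂ (a∈ i)))
      index-inj : Injective _≡_ _≡_ index
      index-inj {i} {i'} eq = a-inj (trans (sym (index-correct i)) (trans (cong f eq) (index-correct i')))
      -- being injective on Fin k, index also reaches the position i of z
      j : Fin k
      j = proj₁ (injection-onto index index-inj i)
      aj≡z : a j ≡ z
      aj≡z = begin
        a j         ≡⟨ sym (index-correct j) ⟩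
        f (index j) ≡⟨ cong f (proj₂ (injection-onto index index-inj i)) ⟩
        f i         ≡⟨ fi≡z ⟩
        z           ∎
        where open ≡-Reasoning

  dim≡∣Dk∣ : (∀ x y → x ≢ y → AtLeast G (λ z → InDk G k z × Distinguishes G x y z) k) →
             Σ ℕ λ m → HasCard G (InDk G k) m × DimK G k m
  dim≡∣Dk∣ pairs = ∣ Dk ∣ , hasCard-subsetOf G inDk? , (Dk , Dk-generator , refl) , minimal
    where
      Dk-generator : IsKMetricGenerator G k Dk
      Dk-generator x y x≢y = AtLeast-mono G {P = λ z → InDk G k z × Distinguishes G x y z}
        {Q = λ z → z ∈ₛ Dk × Distinguishes G x y z}
        (λ (z∈Dk , dist) → ∈subsetOf⁺ inDk? z∈Dk , dist) (pairs x y x≢y)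
      minimal : ∀ S → IsKMetricGenerator G k S → ∣ Dk ∣ ≤ ∣ S ∣
      minimal S generator = p⊆q⇒∣p∣≤∣q∣ λ z∈ → generator⊇Dk S generator (∈subsetOf⁻ inDk? z∈)

proposition29 : ∀ {n : ℕ} (T : Graph n) (k : ℕ) → IsTree T → ¬ IsPathGraph T → 2 ≤ k →
    (∀ (w : Fin n) → InM T w → Ter T w 2 × Varsigma T w k) →
    Σ ℕ λ m → HasCard T (InDk T k) m × DimK T k m
proposition29 T k (conn , acyc) not-path _ hyp =
  Generators.dim≡∣Dk∣ T conn k (KeyLemma.every-pair-good T conn acyc k hyp not-path)
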